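{- The displacement-enumerator of prime parking functions is \[ \mathrm{PPF}_{n+1}(q)=(n+1)! ~~q^n \sum_{\substack{\text{all possible}\\\text{Łukasiewicz paths with} \\ \text{height sequence } \\ (h_0, h_1, \dots, h_n)}} \frac{1}{h_1-h_0+2} ~~\prod_{j=1}^{n} \frac{q^{h_{j}}}{(h_{j}-h_{j-1}+1)!}, \] where $\frac{q^{h_{j}}}{(h_{j}-h_{j-1}+1)!}$ denotes the weight of a step $h_{j-1} \rightarrow h_{j}$ with $h_{j} \geq h_{j-1}-1$ in the Łukasiewicz path.
   Context: A (classical) parking function of length $n$ is a sequence $\pi=(\pi_1,\dots,\pi_n)$ of positive integers whose increasing rearrangement $\lambda_1\le\cdots\le\lambda_n$ satisfies $\lambda_i\le i$. A parking function of length $n+1$ is prime if removing any instance of 1 yields a parking function of length $n$; $\mathrm{PPF}_{n+1}$ denotes this set, and $\mathrm{PPF}_{n+1}(q)=\sum_{\pi\in\mathrm{PPF}_{n+1}} q^{\text{dis}(\pi)}$, where $\text{dis}(\pi)=\frac{m(m+1)}{2}-\sum_i\pi_i$ for $\pi$ of length $m$. A Łukasiewicz word of length $n$ is a sequence $(\ell_1,\dots,\ell_n)$ of integers $\ell_i\ge -1$ with all partial sums $\sum_{i\le k}\ell_i\ge 0$ and $\sum_{i=1}^n\ell_i=0$; the Łukasiewicz path represents $\ell_i$ by the step $(\ell_i+1,\ell_i)$, going from $(0,0)$ to $(n,0)$ without going below the $x$-axis. Its height sequence is $(h_0,\dots,h_n)$ with $h_0=h_n=0$ and $h_j=\sum_{i=1}^j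 \ell_i$. (The sum is over Łukasiewicz paths of length $n$.) -}

module Defs where

open import Data.Nat as ℕ using (ℕ; zero; suc; _≤_; _≤?_; _!)
open import Data.Nat.Properties using (≤-decTotalOrder; _!≢0)
open import Data.Integer as ℤ using (ℤ; +_; -[1+_]; ∣_∣)
open import Data.Rational as ℚ using (ℚ; _/_)
open import Data.List using (List; []; _∷_; length; zip; upTo; map; concatMap; filter; removeAt; lookup; foldr; applyUpTo)
open import Data.List.Relation.Unary.All using (All; all?)
open import Data.List.Sort.InsertionSort.Base ≤-decTotalOrder using (sort)
open import Data.Fin using (Fin)
import Data.Fin.Properties as FinP
open import Data.Product using (_×_; uncurry)
open import Relation.Nullary using (Dec; _×-dec_; _→-dec_)
open import Relation.Binary.PropositionalEquality using (_≡_)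

IsParkingFunction : List ℕ → Set
IsParkingFunction π =
  All (1 ≤_) π ×
  All (uncurry _≤_) (zip (sort π) (applyUpTo suc (length π)))

IsPrimePF : ℕ → List ℕ → Set
IsPrimePF m π =
  length π ≡ m ×
  IsParkingFunction π ×
  ((i : Fin (length π)) → lookup π i ≡ 1 → IsParkingFunction (removeAt π i))

isParkingFunction? : (π : List ℕ) → Dec (IsParkingFunction π)
isParkingFunction? π =
  all? (1 ≤?_) π ×-dec all? (λ p → uncurry _≤?_ p) (zip (sort π) (applyUpTo suc (length π)))

isPrimePF? : (m : ℕ) → (π : List ℕ) → Dec (IsPrimePF m π)
isPrimePF? m π =
  (length π ℕ.≟ m) ×-dec (isParkingFunction? π ×-dec
    FinP.all? (λ i → (lookup π i ℕ.≟ 1) →-dec isParkingFunction? (removeAt π i)))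

seqs : ℕ → ℕ → List (List ℕ)
seqs m zero = [] ∷ []
seqs m (suc k) = concatMap (λ x → map (x ∷_) (seqs m k)) (applyUpTo suc m)

-- PPF_m as an explicit list (every parking function of length m has entries in 1..m)
PPF : ℕ → List (List ℕ)
PPF m = filter (isPrimePF? m) (seqs m m)

sumℕ : List ℕ → ℕ
sumℕ = foldr ℕ._+_ 0

-- dis(π) = m(m+1)/2 − Σ πᵢ  (m = length π); nonnegative for parking functions
dis : List ℕ → ℕ
dis π = (length π ℕ.* suc (length π)) ℕ./ 2 ℕ.∸ sumℕ π

_^ℚ_ : ℚ → ℕ → ℚ
q ^ℚ zero = ℚ.1ℚ
q ^ℚ suc k = q ℚ.* (q ^ℚ k)

sumℚ : List ℚ → ℚ
sumℚ = foldr ℚ._+_ ℚ.0ℚ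

prodℚ : List ℚ → ℚ
prodℚ = foldr ℚ._*_ ℚ.1ℚ

fromℕ : ℕ → ℚ
fromℕ k = (+ k) / 1

invFact : ℕ → ℚ
invFact k = _/_ (+ 1) (k !) {{k !≢0}}

PPFpoly : ℕ → ℚ → ℚ
PPFpoly m q = sumℚ (map (λ π → q ^ℚ dis π) (PPF m))

partialSums : ℤ → List ℤ → List ℤ
partialSums s [] = []
partialSums s (x ∷ xs) = (s ℤ.+ x) ∷ partialSums (s ℤ.+ x) xs

-- heights h₁, …, hₙ (h₀ = 0 is implicit)
heights : List ℤ → List ℤ
heights = partialSums (+ 0)

sumℤ : List ℤ → ℤ
sumℤ = foldr ℤ._+_ (+ 0)

IsŁukasiewicz : ℕ → List ℤ → Set
IsŁukasiewicz n ℓ =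
  length ℓ ≡ n ×
  All (ℤ.-1ℤ ℤ.≤_) ℓ ×
  All (+ 0 ℤ.≤_) (heights ℓ) ×
  sumℤ ℓ ≡ + 0

isŁukasiewicz? : (n : ℕ) → (ℓ : List ℤ) → Dec (IsŁukasiewicz n ℓ)
isŁukasiewicz? n ℓ =
  (length ℓ ℕ.≟ n) ×-dec (all? (ℤ.-1ℤ ℤ.≤?_) ℓ ×-dec
    (all? (+ 0 ℤ.≤?_) (heights ℓ) ×-dec (sumℤ ℓ ℤ.≟ + 0)))

-- integers −1, 0, …, n−1 (any step of a Łukasiewicz word of length n lies here)
stepRange : ℕ → List ℤ
stepRange n = map (λ k → k ℤ.- ℤ.1ℤ) (map +_ (upTo (suc n)))

wordsℤ : List ℤ → ℕ → List (List ℤ)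
wordsℤ R zero = [] ∷ []
wordsℤ R (suc k) = concatMap (λ x → map (x ∷_) (wordsℤ R k)) R

Łuk : ℕ → List (List ℤ)
Łuk n = filter (isŁukasiewicz? n) (wordsℤ (stepRange n) n)

-- weight of a step h_{j-1} → h_j, i.e. ℓ_j = h_j − h_{j−1}:  q^{h_j} / (ℓ_j + 1)!
stepWeight : ℚ → ℤ → ℤ → ℚ
stepWeight q ℓj hj = (q ^ℚ ∣ hj ∣) ℚ.* invFact ∣ ℓj ℤ.+ ℤ.1ℤ ∣

-- 1 / (h₁ − h₀ + 2) = 1 / (ℓ₁ + 2)
firstFactor : List ℤ → ℚ
firstFactor [] = ℚ.1ℚ   -- never used for n ≥ 1
firstFactor (ℓ₁ ∷ _) = (+ 1) / suc ∣ ℓ₁ ℤ.+ ℤ.1ℤ ∣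

pathWeight : ℚ → List ℤ → ℚ
pathWeight q ℓ =
  firstFactor ℓ ℚ.* prodℚ (map (uncurry (stepWeight q)) (zip ℓ (heights ℓ)))

RHS : ℕ → ℚ → ℚ
RHS n q = fromℕ (suc n !) ℚ.* (q ^ℚ n) ℚ.* sumℚ (map (pathWeight q) (Łuk n))

{-# OPTIONS --safe #-}
-- A word π ∈ {1, …, n + 1}^(n+1) is sorted by its letter counts c₁, …, cₙ₊₁, and for a list of
-- length L with entries ≤ L + 1 the parking condition on the sorted list says exactly that the
-- walk from height 0 with steps cᵢ − 1 stays at heights ≥ 0 until its last step reaches −1.
-- Removing a 1 from π lowers c₁ by one, so π is a prime parking function iff ℓ₁ = c₁ − 2 and
-- ℓⱼ = cⱼ − 1 (2 ≤ j ≤ n) form a Łukasiewicz path and cₙ₊₁ = 0; then dis π = n + h₁ + ⋯ + hₙ,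
-- the area under the walk. The words with given counts number (n + 1)!/(c₁! ⋯ cₙ₊₁!), and
-- 1/c₁! = 1/(ℓ₁ + 2) · 1/(ℓ₁ + 1)! while 1/cⱼ! = 1/(ℓⱼ + 1)!, which is the stated formula.
module Submission where

open import Defs
open import Data.Nat as ℕ using (ℕ; zero; suc; _≤_; _<_; z≤n; s≤s; _∸_; _!; NonZero)
import Data.Nat.Properties as ℕP
open import Data.Nat.Combinatorics using (_C_; k>n⇒nCk≡0; nCk+nC[k+1]≡[n+1]C[k+1]; k![n∸k]!∣n!)
open import Data.Nat.Combinatorics.Specification using (nCk≡n!/k![n-k]!)
open import Data.Nat.DivMod using (m/n*n≡m; m*n/n≡m)
open import Data.Nat.ListAction.Properties using (sum-++; sum-↭)
open import Data.Nat.Tactic.RingSolver using (solve-∀)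
open import Data.Integer as ℤ using (ℤ)
import Data.Integer.Properties as ℤP
open import Data.Rational as ℚ using (ℚ; 0ℚ; 1ℚ; _/_; fromℚᵘ)
import Data.Rational.Properties as ℚP
open import Data.Rational.Solver using (module +-*-Solver)
open import Data.Rational.Unnormalised as ℚᵘ using (mkℚᵘ; *≡*)
import Data.Rational.Unnormalised.Properties as ℚᵘP
open import Algebra.Bundles using (CommutativeMonoid)
open import Algebra.Properties.CommutativeSemigroup (CommutativeMonoid.commutativeSemigroup ℚP.+-0-commutativeMonoid)
  using (interchange; x∙yz≈y∙xz)
open import Data.Bool using (true; false; T)
open import Data.Empty using (⊥-elim)
import Data.Fin as Fin
open import Data.List using (List; []; _∷_; map; _++_; concatMap; filter; length; replicate; zip; applyUpTo; upTo; lookup; removeAt)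
import Data.List.Properties as ListP
open import Data.List.Relation.Unary.All using (All; []; _∷_; all?)
import Data.List.Relation.Unary.All as All
open import Data.List.Relation.Unary.All.Properties using (++⁺; concat⁺; map⁺; replicate⁺)
open import Data.List.Relation.Unary.AllPairs using (AllPairs; []; _∷_)
open import Data.List.Relation.Binary.Permutation.Propositional.Properties using (↭-length)
open import Data.List.Sort.InsertionSort.Base ℕP.≤-decTotalOrder using (insert; sort)
open import Data.List.Sort.InsertionSort.Properties ℕP.≤-decTotalOrder using (sort-↭)
open import Data.Product using (_×_; _,_; proj₁; proj₂; ∃-syntax; uncurry)
open import Data.Unit using (⊤; tt)
open import Function using (_∘_; _⇔_; mk⇔; Equivalence)
open import Function.Construct.Composition using (_⇔-∘_)
open import Relation.Nullary using (Dec; yes; no; ¬_; _×-dec_)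
open import Relation.Binary.PropositionalEquality
open ≡-Reasoning

module _ where
  open import Data.Rational using (_+_; _*_)
  open import Data.Integer using (+_)

  fromℚᵘ-homo-* : ∀ p q → fromℚᵘ p * fromℚᵘ q ≡ fromℚᵘ (p ℚᵘ.* q)
  fromℚᵘ-homo-* p q = ℚP.toℚᵘ-injective
    (ℚᵘP.≃-trans (ℚP.toℚᵘ-homo-* (fromℚᵘ p) (fromℚᵘ q))
    (ℚᵘP.≃-trans (ℚᵘP.*-cong (ℚP.toℚᵘ-fromℚᵘ p) (ℚP.toℚᵘ-fromℚᵘ q)) (ℚᵘP.≃-sym (ℚP.toℚᵘ-fromℚᵘ _))))

  fromℚᵘ-homo-+ : ∀ p q → fromℚᵘ p + fromℚᵘ q ≡ fromℚᵘ (p ℚᵘ.+ q)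
  fromℚᵘ-homo-+ p q = ℚP.toℚᵘ-injective
    (ℚᵘP.≃-trans (ℚP.toℚᵘ-homo-+ (fromℚᵘ p) (fromℚᵘ q))
    (ℚᵘP.≃-trans (ℚᵘP.+-cong (ℚP.toℚᵘ-fromℚᵘ p) (ℚP.toℚᵘ-fromℚᵘ q)) (ℚᵘP.≃-sym (ℚP.toℚᵘ-fromℚᵘ _))))

  fromℕ-homo-* : ∀ a b → fromℕ (a ℕ.* b) ≡ fromℕ a * fromℕ b
  fromℕ-homo-* a b = sym (trans (fromℚᵘ-homo-* (mkℚᵘ (+ a) 0) (mkℚᵘ (+ b) 0))
    (ℚP.fromℚᵘ-cong {mkℚᵘ (+ a) 0 ℚᵘ.* mkℚᵘ (+ b) 0} {mkℚᵘ (+ (a ℕ.* b)) 0}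
      (*≡* (cong (ℤ._* + 1) (sym (ℤP.pos-* a b))))))

  fromℕ-homo-+ : ∀ a b → fromℕ (a ℕ.+ b) ≡ fromℕ a + fromℕ b
  fromℕ-homo-+ a b = sym (trans (fromℚᵘ-homo-+ (mkℚᵘ (+ a) 0) (mkℚᵘ (+ b) 0))
    (ℚP.fromℚᵘ-cong {mkℚᵘ (+ a) 0 ℚᵘ.+ mkℚᵘ (+ b) 0} {mkℚᵘ (+ (a ℕ.+ b)) 0}
      (*≡* (cong (ℤ._* + 1) numerator))))
    where
    numerator : + a ℤ.* + 1 ℤ.+ + b ℤ.* + 1 ≡ + (a ℕ.+ b)
    numerator = trans (cong₂ ℤ._+_ (ℤP.*-identityʳ (+ a)) (ℤP.*-identityʳ (+ b))) (sym (ℤP.pos-+ a b))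

  fromℕ-*-1/ : ∀ d .{{_ : NonZero d}} → fromℕ d * ((+ 1) / d) ≡ 1ℚ
  fromℕ-*-1/ (suc d) = trans (fromℚᵘ-homo-* (mkℚᵘ (+ suc d) 0) (mkℚᵘ (+ 1) d))
    (ℚP.fromℚᵘ-cong {mkℚᵘ (+ suc d) 0 ℚᵘ.* mkℚᵘ (+ 1) d} {mkℚᵘ (+ 1) 0}
      (*≡* (cong +_ (trans (ℕP.*-comm (suc d ℕ.* 1) 1) (cong (1 ℕ.*_) (ℕP.*-comm (suc d) 1))))))

  1/-homo-* : ∀ d e .{{_ : NonZero d}} .{{_ : NonZero e}} .{{_ : NonZero (d ℕ.* e)}} →
              ((+ 1) / d) * ((+ 1) / e) ≡ (+ 1) / (d ℕ.* e)
  1/-homo-* (suc d) (suc e) = fromℚᵘ-homo-* (mkℚᵘ (+ 1) d) (mkℚᵘ (+ 1) e)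

  k!*invFact[k]≡1 : ∀ k → fromℕ (k !) * invFact k ≡ 1ℚ
  k!*invFact[k]≡1 k = fromℕ-*-1/ (k !) {{k ℕP.!≢0}}

  invFact-suc : ∀ k → ((+ 1) / suc k) * invFact k ≡ invFact (suc k)
  invFact-suc k = 1/-homo-* (suc k) (k !) {{_}} {{k ℕP.!≢0}} {{suc k ℕP.!≢0}}

  ^ℚ-distribˡ-+-* : ∀ q a b → q ^ℚ (a ℕ.+ b) ≡ q ^ℚ a * q ^ℚ b
  ^ℚ-distribˡ-+-* q zero b = sym (ℚP.*-identityˡ _)
  ^ℚ-distribˡ-+-* q (suc a) b = trans (cong (q *_) (^ℚ-distribˡ-+-* q a b)) (sym (ℚP.*-assoc q _ _))

  nCk*[n∸k]!≡n!*invFact[k] : ∀ n k → k ≤ n → fromℕ (n C k) * fromℕ ((n ∸ k) !) ≡ fromℕ (n !) * invFact k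
  nCk*[n∸k]!≡n!*invFact[k] n k k≤n = begin
    B * R                                      ≡⟨ ℚP.*-identityʳ (B * R) ⟨
    B * R * 1ℚ                                 ≡⟨ cong (B * R *_) (k!*invFact[k]≡1 k) ⟨
    B * R * (K * I)                            ≡⟨ solve 4 (λ B K R I → B :* R :* (K :* I) := B :* (K :* R) :* I) refl B K R I ⟩
    B * (K * R) * I                            ≡⟨ cong (_* I) (trans (fromℕ-homo-* (n C k) _) (cong (B *_) (fromℕ-homo-* (k !) _))) ⟨
    fromℕ ((n C k) ℕ.* (k ! ℕ.* (n ∸ k) !)) * I  ≡⟨ cong (λ m → fromℕ m * I) n!≡nCk*k!*[n∸k]! ⟩
    fromℕ (n !) * I                            ∎
    where
    open +-*-Solver
    B = fromℕ (n C k)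
    K = fromℕ (k !)
    R = fromℕ ((n ∸ k) !)
    I = invFact k
    n!≡nCk*k!*[n∸k]! : (n C k) ℕ.* (k ! ℕ.* (n ∸ k) !) ≡ n !
    n!≡nCk*k!*[n∸k]! = trans (cong (ℕ._* (k ! ℕ.* (n ∸ k) !)) (nCk≡n!/k![n-k]! k≤n))
                             (m/n*n≡m {{_}} (k![n∸k]!∣n! k≤n))

module _ where
  open import Data.Rational using (_+_; _*_)

  infix 5 sumOver sumBelow

  sumOver : {A : Set} → List A → (A → ℚ) → ℚ
  sumOver xs f = sumℚ (map f xs)

  syntax sumOver xs (λ x → e) = ∑[ x ∈ xs ] e

  sumBelow : ℕ → (ℕ → ℚ) → ℚ
  sumBelow zero    f = 0ℚ
  sumBelow (suc K) f = f 0 + sumBelow K (f ∘ suc)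

  syntax sumBelow K (λ k → e) = ∑[ k < K ] e

  keepIf : {P : Set} → Dec P → ℚ → ℚ
  keepIf (yes _) v = v
  keepIf (no _)  v = 0ℚ

  module _ {A : Set} where

    sumOver-++ : ∀ (f : A → ℚ) xs ys → (∑[ x ∈ xs ++ ys ] f x) ≡ (∑[ x ∈ xs ] f x) + (∑[ x ∈ ys ] f x)
    sumOver-++ f []       ys = sym (ℚP.+-identityˡ _)
    sumOver-++ f (x ∷ xs) ys = trans (cong (f x +_) (sumOver-++ f xs ys)) (sym (ℚP.+-assoc (f x) _ _))

    sumOver-cong : ∀ {f g : A → ℚ} → (∀ x → f x ≡ g x) → ∀ xs → (∑[ x ∈ xs ] f x) ≡ (∑[ x ∈ xs ] g x)
    sumOver-cong f≗g xs = cong sumℚ (ListP.map-cong f≗g xs)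

    sumOver-congAll : ∀ {P : A → Set} {f g : A → ℚ} → (∀ {x} → P x → f x ≡ g x) →
                      ∀ {xs} → All P xs → (∑[ x ∈ xs ] f x) ≡ (∑[ x ∈ xs ] g x)
    sumOver-congAll f≗g ps = cong sumℚ (ListP.map-cong-local (All.map f≗g ps))

    sumOver-0 : ∀ (xs : List A) → (∑[ x ∈ xs ] 0ℚ) ≡ 0ℚ
    sumOver-0 []       = refl
    sumOver-0 (x ∷ xs) = trans (ℚP.+-identityˡ _) (sumOver-0 xs)

    *-distribˡ-sumOver : ∀ c (f : A → ℚ) xs → c * (∑[ x ∈ xs ] f x) ≡ (∑[ x ∈ xs ] c * f x)
    *-distribˡ-sumOver c f []       = ℚP.*-zeroʳ c
    *-distribˡ-sumOver c f (x ∷ xs) = trans (ℚP.*-distribˡ-+ c _ _) (cong (c * f x +_) (*-distribˡ-sumOver c f xs))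

    sumOver-filter : ∀ {P : A → Set} (P? : ∀ x → Dec (P x)) (f : A → ℚ) xs →
                     (∑[ x ∈ filter P? xs ] f x) ≡ (∑[ x ∈ xs ] keepIf (P? x) (f x))
    sumOver-filter P? f []       = refl
    sumOver-filter P? f (x ∷ xs) with P? x
    ... | yes _ = cong (f x +_) (sumOver-filter P? f xs)
    ... | no _  = trans (sumOver-filter P? f xs) (sym (ℚP.+-identityˡ _))

  sumOver-map : ∀ {A B : Set} (f : B → ℚ) (g : A → B) xs → (∑[ y ∈ map g xs ] f y) ≡ (∑[ x ∈ xs ] f (g x))
  sumOver-map f g xs = cong sumℚ (sym (ListP.map-∘ xs))

  sumOver-concatMap : ∀ {A B : Set} (f : B → ℚ) (g : A → List B) xs →
                      (∑[ y ∈ concatMap g xs ] f y) ≡ (∑[ x ∈ xs ] ∑[ y ∈ g x ] f y)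
  sumOver-concatMap f g []       = refl
  sumOver-concatMap f g (x ∷ xs) =
    trans (sumOver-++ f (g x) (concatMap g xs)) (cong ((∑[ y ∈ g x ] f y) +_) (sumOver-concatMap f g xs))

  sumBelow-cong : ∀ {f g : ℕ → ℚ} K → (∀ {k} → k < K → f k ≡ g k) → (∑[ k < K ] f k) ≡ (∑[ k < K ] g k)
  sumBelow-cong zero    f≗g = refl
  sumBelow-cong (suc K) f≗g = cong₂ _+_ (f≗g (s≤s z≤n)) (sumBelow-cong K (f≗g ∘ s≤s))

  sumBelow-+ : ∀ (f g : ℕ → ℚ) K → (∑[ k < K ] (f k + g k)) ≡ (∑[ k < K ] f k) + (∑[ k < K ] g k)
  sumBelow-+ f g zero    = refl
  sumBelow-+ f g (suc K) = trans (cong (f 0 + g 0 +_) (sumBelow-+ (f ∘ suc) (g ∘ suc) K)) (interchange (f 0) (g 0) _ _)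

  *-distribˡ-sumBelow : ∀ c (f : ℕ → ℚ) K → c * (∑[ k < K ] f k) ≡ (∑[ k < K ] c * f k)
  *-distribˡ-sumBelow c f zero    = ℚP.*-zeroʳ c
  *-distribˡ-sumBelow c f (suc K) = trans (ℚP.*-distribˡ-+ c _ _) (cong (c * f 0 +_) (*-distribˡ-sumBelow c (f ∘ suc) K))

  sumBelow-zero : ∀ {f : ℕ → ℚ} K → (∀ {k} → k < K → f k ≡ 0ℚ) → (∑[ k < K ] f k) ≡ 0ℚ
  sumBelow-zero zero    f≡0 = refl
  sumBelow-zero (suc K) f≡0 = trans (cong₂ _+_ (f≡0 (s≤s z≤n)) (sumBelow-zero K (f≡0 ∘ s≤s))) (ℚP.+-identityˡ 0ℚ)

  sumBelow-suc : ∀ (f : ℕ → ℚ) K → (∑[ k < suc K ] f k) ≡ (∑[ k < K ] f k) + f K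
  sumBelow-suc f zero    = trans (ℚP.+-identityʳ (f 0)) (sym (ℚP.+-identityˡ (f 0)))
  sumBelow-suc f (suc K) = trans (cong (f 0 +_) (sumBelow-suc (f ∘ suc) K)) (sym (ℚP.+-assoc (f 0) _ _))

  sumBelow-truncate : ∀ {f : ℕ → ℚ} N K → N ≤ K → (∀ {k} → N ≤ k → f k ≡ 0ℚ) → (∑[ k < K ] f k) ≡ (∑[ k < N ] f k)
  sumBelow-truncate zero    K       _         f≡0 = sumBelow-zero K (λ _ → f≡0 z≤n)
  sumBelow-truncate {f} (suc N) (suc K) (s≤s N≤K) f≡0 = cong (f 0 +_) (sumBelow-truncate N K N≤K (f≡0 ∘ s≤s))

  sumOver-sumBelow : ∀ {A : Set} (f : A → ℕ → ℚ) K xs → (∑[ x ∈ xs ] ∑[ k < K ] f x k) ≡ (∑[ k < K ] ∑[ x ∈ xs ] f x k)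
  sumOver-sumBelow f K []       = sym (sumBelow-zero K (λ _ → refl))
  sumOver-sumBelow f K (x ∷ xs) = trans (cong ((∑[ k < K ] f x k) +_) (sumOver-sumBelow f K xs))
                                        (sym (sumBelow-+ (f x) (λ k → ∑[ y ∈ xs ] f y k) K))

  sumOver-applyUpTo : ∀ (f : ℕ → ℚ) g K → (∑[ x ∈ applyUpTo g K ] f x) ≡ (∑[ k < K ] f (g k))
  sumOver-applyUpTo f g zero    = refl
  sumOver-applyUpTo f g (suc K) = cong (f (g 0) +_) (sumOver-applyUpTo f (g ∘ suc) K)

  keepIf-cong : ∀ {P Q : Set} (p : Dec P) (q : Dec Q) → P ⇔ Q → ∀ v → keepIf p v ≡ keepIf q v
  keepIf-cong (yes _) (yes _) _   v = refl
  keepIf-cong (yes x) (no ¬y) P⇔Q v = ⊥-elim (¬y (Equivalence.to P⇔Q x))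
  keepIf-cong (no ¬x) (yes y) P⇔Q v = ⊥-elim (¬x (Equivalence.from P⇔Q y))
  keepIf-cong (no _)  (no _)  _   v = refl

  keepIf-yes : ∀ {P : Set} (p : Dec P) → P → ∀ v → keepIf p v ≡ v
  keepIf-yes (yes _) _ v = refl
  keepIf-yes (no ¬x) x v = ⊥-elim (¬x x)

  keepIf-no : ∀ {P : Set} (p : Dec P) → ¬ P → ∀ v → keepIf p v ≡ 0ℚ
  keepIf-no (yes x) ¬x v = ⊥-elim (¬x x)
  keepIf-no (no _)  _  v = refl

  keepIf-*ˡ : ∀ {P : Set} (p : Dec P) a b → keepIf p (a * b) ≡ a * keepIf p b
  keepIf-*ˡ (yes _) a b = refl
  keepIf-*ˡ (no _)  a b = sym (ℚP.*-zeroʳ a)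

  keepIf-×-dec : ∀ {P Q : Set} (p : Dec P) (q : Dec Q) a b → keepIf (p ×-dec q) (a * b) ≡ keepIf p (a * keepIf q b)
  keepIf-×-dec (yes _) (yes _) a b = refl
  keepIf-×-dec (yes _) (no _)  a b = sym (ℚP.*-zeroʳ a)
  keepIf-×-dec (no _)  q       a b = refl

-- Words, letter counts and multinomial sums

words : {X : Set} → List X → ℕ → List (List X)
words A zero    = [] ∷ []
words A (suc N) = concatMap (λ x → map (x ∷_) (words A N)) A

seqs≡words : ∀ m N → seqs m N ≡ words (applyUpTo suc m) N
seqs≡words m zero    = refl
seqs≡words m (suc N) = cong (λ W → concatMap (λ x → map (x ∷_) W) (applyUpTo suc m)) (seqs≡words m N)

wordsℤ≡words : ∀ R N → wordsℤ R N ≡ words R N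
wordsℤ≡words R zero    = refl
wordsℤ≡words R (suc N) = cong (λ W → concatMap (λ x → map (x ∷_) W) R) (wordsℤ≡words R N)

All-words : ∀ {X : Set} {P : X → Set} {A} N → All P A → All (λ w → length w ≡ N × All P w) (words A N)
All-words zero    pA = (refl , []) ∷ []
All-words (suc N) pA =
  concat⁺ (map⁺ (All.map (λ px → map⁺ (All.map (λ (len , pw) → cong suc len , px ∷ pw) (All-words N pA))) pA))

sumOver-words-suc : ∀ {X : Set} (f : List X → ℚ) A N →
                    (∑[ w ∈ words A (suc N) ] f w) ≡ (∑[ x ∈ A ] ∑[ w ∈ words A N ] f (x ∷ w))
sumOver-words-suc f A N = trans (sumOver-concatMap f (λ x → map (x ∷_) (words A N)) A)
                                (sumOver-cong (λ x → sumOver-map f (x ∷_) (words A N)) A)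

count : ℕ → List ℕ → ℕ
count a [] = 0
count a (x ∷ w) with a ℕ.≟ x
... | yes _ = suc (count a w)
... | no  _ = count a w

deleteAll : ℕ → List ℕ → List ℕ
deleteAll a [] = []
deleteAll a (x ∷ w) with a ℕ.≟ x
... | yes _ = deleteAll a w
... | no  _ = x ∷ deleteAll a w

counts : List ℕ → List ℕ → List ℕ
counts A w = map (λ a → count a w) A

count-here : ∀ a w → count a (a ∷ w) ≡ suc (count a w)
count-here a w with a ℕ.≟ a
... | yes _  = refl
... | no a≢a = ⊥-elim (a≢a refl)

count-there : ∀ {a x} w → a ≢ x → count a (x ∷ w) ≡ count a w
count-there {a} {x} w a≢x with a ℕ.≟ x
... | yes a≡x = ⊥-elim (a≢x a≡x)
... | no  _   = refl

deleteAll-here : ∀ a w → deleteAll a (a ∷ w) ≡ deleteAll a w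
deleteAll-here a w with a ℕ.≟ a
... | yes _  = refl
... | no a≢a = ⊥-elim (a≢a refl)

deleteAll-there : ∀ {a x} w → a ≢ x → deleteAll a (x ∷ w) ≡ x ∷ deleteAll a w
deleteAll-there {a} {x} w a≢x with a ℕ.≟ x
... | yes a≡x = ⊥-elim (a≢x a≡x)
... | no  _   = refl

count-deleteAll : ∀ {a u} w → u ≢ a → count u (deleteAll a w) ≡ count u w
count-deleteAll [] u≢a = refl
count-deleteAll {a} {u} (x ∷ w) u≢a with a ℕ.≟ x
... | yes refl = trans (count-deleteAll w u≢a) (sym (count-there w u≢a))
... | no  _ with u ℕ.≟ x
...   | yes _ = cong suc (count-deleteAll w u≢a)
...   | no  _ = count-deleteAll w u≢a

counts-deleteAll : ∀ {a A} w → All (a ≢_) A → counts A (deleteAll a w) ≡ counts A w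
counts-deleteAll w []            = refl
counts-deleteAll w (a≢u ∷ a≢A) = cong₂ _∷_ (count-deleteAll w (a≢u ∘ sym)) (counts-deleteAll w a≢A)

module _ where
  open import Data.Rational using (_+_; _*_)

  -- ∑ over (k₁, …, kᵣ) with k₁ + ⋯ + kᵣ = N of Φ (k₁ ∷ ⋯ ∷ kᵣ ∷ []) / (k₁! ⋯ kᵣ!)
  multinomialSum : ℕ → ℕ → (List ℕ → ℚ) → ℚ
  multinomialSum zero    zero    Φ = Φ []
  multinomialSum zero    (suc N) Φ = 0ℚ
  multinomialSum (suc r) N       Φ = ∑[ k < suc N ] invFact k * multinomialSum r (N ∸ k) (Φ ∘ (k ∷_))

  multinomialSum-congLength : ∀ r N {Φ Ψ : List ℕ → ℚ} → (∀ c → length c ≡ r → Φ c ≡ Ψ c) →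
                              multinomialSum r N Φ ≡ multinomialSum r N Ψ
  multinomialSum-congLength zero    zero    Φ≗Ψ = Φ≗Ψ [] refl
  multinomialSum-congLength zero    (suc N) Φ≗Ψ = refl
  multinomialSum-congLength (suc r) N       Φ≗Ψ = sumBelow-cong (suc N) λ {k} _ →
    cong (invFact k *_) (multinomialSum-congLength r (N ∸ k) (λ c len → Φ≗Ψ (k ∷ c) (cong suc len)))

  *-distribˡ-multinomialSum : ∀ r N α (Φ : List ℕ → ℚ) → α * multinomialSum r N Φ ≡ multinomialSum r N (λ c → α * Φ c)
  *-distribˡ-multinomialSum zero    zero    α Φ = refl
  *-distribˡ-multinomialSum zero    (suc N) α Φ = ℚP.*-zeroʳ α
  *-distribˡ-multinomialSum (suc r) N       α Φ = begin
    α * (∑[ k < suc N ] invFact k * M k Φ)        ≡⟨ *-distribˡ-sumBelow α (λ k → invFact k * M k Φ) (suc N) ⟩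
    (∑[ k < suc N ] α * (invFact k * M k Φ))      ≡⟨ sumBelow-cong (suc N) (λ {k} _ →
                                                       solve 3 (λ a b c → a :* (b :* c) := b :* (a :* c)) refl α (invFact k) (M k Φ)) ⟩
    (∑[ k < suc N ] invFact k * (α * M k Φ))      ≡⟨ sumBelow-cong (suc N) (λ {k} _ → cong (invFact k *_)
                                                       (*-distribˡ-multinomialSum r (N ∸ k) α (Φ ∘ (k ∷_)))) ⟩
    (∑[ k < suc N ] invFact k * M k (λ c → α * Φ c)) ∎
    where
    open +-*-Solver
    M : ℕ → (List ℕ → ℚ) → ℚ
    M k Ψ = multinomialSum r (N ∸ k) (Ψ ∘ (k ∷_))

  multinomialSum-zero : ∀ r N → multinomialSum r N (λ _ → 0ℚ) ≡ 0ℚ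
  multinomialSum-zero r N =
    trans (sym (*-distribˡ-multinomialSum r N 0ℚ (λ _ → 0ℚ))) (ℚP.*-zeroˡ (multinomialSum r N (λ _ → 0ℚ)))

  binomialSum : ℕ → (ℕ → ℚ) → ℚ
  binomialSum N Z = ∑[ k < suc N ] fromℕ (N C k) * Z k

  binomialSum-suc : ∀ N Z → binomialSum (suc N) Z ≡ binomialSum N (Z ∘ suc) + binomialSum N Z
  binomialSum-suc N Z = begin
    Z₀ + (∑[ k < suc N ] fromℕ (suc N C suc k) * Z (suc k))
      ≡⟨ cong (Z₀ +_) (trans (sumBelow-cong (suc N) (λ {k} _ → pascal k))
                              (sumBelow-+ (λ k → fromℕ (N C k) * Z (suc k)) (λ k → fromℕ (N C suc k) * Z (suc k)) (suc N))) ⟩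
    Z₀ + (binomialSum N (Z ∘ suc) + S)     ≡⟨ x∙yz≈y∙xz Z₀ (binomialSum N (Z ∘ suc)) S ⟩
    binomialSum N (Z ∘ suc) + (Z₀ + S)     ≡⟨ cong (binomialSum N (Z ∘ suc) +_) lastTermVanishes ⟩
    binomialSum N (Z ∘ suc) + binomialSum N Z ∎
    where
    Z₀ = fromℕ (N C 0) * Z 0
    S  = ∑[ k < suc N ] fromℕ (N C suc k) * Z (suc k)
    pascal : ∀ k → fromℕ (suc N C suc k) * Z (suc k) ≡ fromℕ (N C k) * Z (suc k) + fromℕ (N C suc k) * Z (suc k)
    pascal k = begin
      fromℕ (suc N C suc k) * Z (suc k)                       ≡⟨ cong (λ m → fromℕ m * Z (suc k)) (nCk+nC[k+1]≡[n+1]C[k+1] N k) ⟨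
      fromℕ ((N C k) ℕ.+ (N C suc k)) * Z (suc k)             ≡⟨ cong (_* Z (suc k)) (fromℕ-homo-+ (N C k) _) ⟩
      (fromℕ (N C k) + fromℕ (N C suc k)) * Z (suc k)         ≡⟨ ℚP.*-distribʳ-+ (Z (suc k)) (fromℕ (N C k)) (fromℕ (N C suc k)) ⟩
      fromℕ (N C k) * Z (suc k) + fromℕ (N C suc k) * Z (suc k) ∎
    lastTermVanishes : Z₀ + S ≡ binomialSum N Z
    lastTermVanishes = begin
      (∑[ k < suc (suc N) ] fromℕ (N C k) * Z k)                 ≡⟨ sumBelow-suc (λ k → fromℕ (N C k) * Z k) (suc N) ⟩
      binomialSum N Z + fromℕ (N C suc N) * Z (suc N)           ≡⟨ cong (λ m → binomialSum N Z + fromℕ m * Z (suc N)) (k>n⇒nCk≡0 (ℕP.n<1+n N)) ⟩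
      binomialSum N Z + 0ℚ * Z (suc N)                          ≡⟨ cong (binomialSum N Z +_) (ℚP.*-zeroˡ (Z (suc N))) ⟩
      binomialSum N Z + 0ℚ                                      ≡⟨ ℚP.+-identityʳ (binomialSum N Z) ⟩
      binomialSum N Z                                           ∎

  binomialSum-cong : ∀ N {Y Z : ℕ → ℚ} → (∀ {k} → k ≤ N → Y k ≡ Z k) → binomialSum N Y ≡ binomialSum N Z
  binomialSum-cong N Y≗Z = sumBelow-cong (suc N) (λ {k} k<1+N → cong (fromℕ (N C k) *_) (Y≗Z (ℕP.≤-pred k<1+N)))

  sumOver-binomialSum : ∀ {X : Set} (Z : X → ℕ → ℚ) N xs →
                        (∑[ x ∈ xs ] binomialSum N (Z x)) ≡ binomialSum N (λ k → ∑[ x ∈ xs ] Z x k)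
  sumOver-binomialSum Z N xs = trans (sumOver-sumBelow (λ x k → fromℕ (N C k) * Z x k) (suc N) xs)
    (sumBelow-cong (suc N) (λ {k} _ → sym (*-distribˡ-sumOver (fromℕ (N C k)) (λ x → Z x k) xs)))

  -- N C k chooses the positions of the k letters a.
  sumOver-words-byCount : ∀ {a A} → All (a ≢_) A → ∀ N (G : ℕ → List ℕ → ℚ) →
    (∑[ w ∈ words (a ∷ A) N ] G (count a w) (deleteAll a w)) ≡ binomialSum N (λ k → ∑[ u ∈ words A (N ∸ k) ] G k u)
  sumOver-words-byCount a∉A zero G = trans (sym (ℚP.*-identityˡ _)) (sym (ℚP.+-identityʳ _))
  sumOver-words-byCount {a} {A} a∉A (suc N) G = begin
    (∑[ w ∈ words (a ∷ A) (suc N) ] F w)                                   ≡⟨ sumOver-words-suc F (a ∷ A) N ⟩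
    (∑[ w ∈ W ] F (a ∷ w)) + (∑[ b ∈ A ] ∑[ w ∈ W ] F (b ∷ w))             ≡⟨ cong₂ _+_ startingWith-a startingWithout-a ⟩
    binomialSum N (Z ∘ suc) + binomialSum N Z                              ≡⟨ binomialSum-suc N Z ⟨
    binomialSum (suc N) Z                                                  ∎
    where
    W = words (a ∷ A) N
    F : List ℕ → ℚ
    F w = G (count a w) (deleteAll a w)
    Z : ℕ → ℚ
    Z k = ∑[ u ∈ words A (suc N ∸ k) ] G k u
    startingWith-a : (∑[ w ∈ W ] F (a ∷ w)) ≡ binomialSum N (Z ∘ suc)
    startingWith-a = trans (sumOver-cong (λ w → cong₂ G (count-here a w) (deleteAll-here a w)) W)
                           (sumOver-words-byCount a∉A N (G ∘ suc))
    startingWithout-a : (∑[ b ∈ A ] ∑[ w ∈ W ] F (b ∷ w)) ≡ binomialSum N Z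
    startingWithout-a = begin
      (∑[ b ∈ A ] ∑[ w ∈ W ] F (b ∷ w))
        ≡⟨ sumOver-congAll (λ a≢b → sumOver-cong (λ w → cong₂ G (count-there w a≢b) (deleteAll-there w a≢b)) W) a∉A ⟩
      (∑[ b ∈ A ] ∑[ w ∈ W ] G (count a w) (b ∷ deleteAll a w))
        ≡⟨ sumOver-cong (λ b → sumOver-words-byCount a∉A N (λ k u → G k (b ∷ u))) A ⟩
      (∑[ b ∈ A ] binomialSum N (λ k → ∑[ u ∈ words A (N ∸ k) ] G k (b ∷ u)))
        ≡⟨ sumOver-binomialSum (λ b k → ∑[ u ∈ words A (N ∸ k) ] G k (b ∷ u)) N A ⟩
      binomialSum N (λ k → ∑[ b ∈ A ] ∑[ u ∈ words A (N ∸ k) ] G k (b ∷ u))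
        ≡⟨ binomialSum-cong N (λ {k} _ → sym (sumOver-words-suc (G k) A (N ∸ k))) ⟩
      binomialSum N (λ k → ∑[ u ∈ words A (suc (N ∸ k)) ] G k u)
        ≡⟨ binomialSum-cong N (λ {k} k≤N → cong (λ m → ∑[ u ∈ words A m ] G k u) (sym (ℕP.+-∸-assoc 1 k≤N))) ⟩
      binomialSum N Z ∎

  sumOver-counts≡multinomialSum : ∀ {A} → AllPairs _≢_ A → ∀ N (Φ : List ℕ → ℚ) →
    (∑[ w ∈ words A N ] Φ (counts A w)) ≡ fromℕ (N !) * multinomialSum (length A) N Φ
  sumOver-counts≡multinomialSum [] zero    Φ = trans (ℚP.+-identityʳ (Φ [])) (sym (ℚP.*-identityˡ (Φ [])))
  sumOver-counts≡multinomialSum [] (suc N) Φ = sym (ℚP.*-zeroʳ (fromℕ (suc N !)))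
  sumOver-counts≡multinomialSum {a ∷ A} (a∉A ∷ distinct) N Φ = begin
    (∑[ w ∈ words (a ∷ A) N ] Φ (counts (a ∷ A) w))
      ≡⟨ sumOver-cong (λ w → cong (λ c → Φ (count a w ∷ c)) (sym (counts-deleteAll w a∉A))) (words (a ∷ A) N) ⟩
    (∑[ w ∈ words (a ∷ A) N ] Φ (count a w ∷ counts A (deleteAll a w)))
      ≡⟨ sumOver-words-byCount a∉A N (λ k u → Φ (k ∷ counts A u)) ⟩
    binomialSum N (λ k → ∑[ u ∈ words A (N ∸ k) ] Φ (k ∷ counts A u))
      ≡⟨ binomialSum-cong N (λ {k} _ → sumOver-counts≡multinomialSum distinct (N ∸ k) (Φ ∘ (k ∷_))) ⟩
    binomialSum N (λ k → fromℕ ((N ∸ k) !) * M k)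
      ≡⟨ sumBelow-cong (suc N) (λ {k} k<1+N → multinomialTerm k (ℕP.≤-pred k<1+N)) ⟩
    (∑[ k < suc N ] fromℕ (N !) * (invFact k * M k))
      ≡⟨ *-distribˡ-sumBelow (fromℕ (N !)) (λ k → invFact k * M k) (suc N) ⟨
    fromℕ (N !) * multinomialSum (length (a ∷ A)) N Φ ∎
    where
    M : ℕ → ℚ
    M k = multinomialSum (length A) (N ∸ k) (Φ ∘ (k ∷_))
    multinomialTerm : ∀ k → k ≤ N → fromℕ (N C k) * (fromℕ ((N ∸ k) !) * M k) ≡ fromℕ (N !) * (invFact k * M k)
    multinomialTerm k k≤N = begin
      fromℕ (N C k) * (fromℕ ((N ∸ k) !) * M k)  ≡⟨ ℚP.*-assoc (fromℕ (N C k)) _ (M k) ⟨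
      fromℕ (N C k) * fromℕ ((N ∸ k) !) * M k    ≡⟨ cong (_* M k) (nCk*[n∸k]!≡n!*invFact[k] N k k≤N) ⟩
      fromℕ (N !) * invFact k * M k              ≡⟨ ℚP.*-assoc (fromℕ (N !)) (invFact k) (M k) ⟩
      fromℕ (N !) * (invFact k * M k)            ∎

-- Parking functions through their letter counts

module _ where
  open import Data.Nat using (_+_; _*_)

  range : ℕ → ℕ → List ℕ
  range v zero    = []
  range v (suc k) = v ∷ range (suc v) k

  InRange : ℕ → ℕ → ℕ → Set
  InRange v k x = v ≤ x × x < v + k

  runs : ℕ → List ℕ → List ℕ
  runs v []      = []
  runs v (k ∷ c) = replicate k v ++ runs (suc v) c

  All-range : ∀ v k → All (InRange v k) (range v k)
  All-range v zero    = []
  All-range v (suc k) = (ℕP.≤-refl , ℕP.m<m+n v (s≤s z≤n)) ∷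
    All.map (λ (v<x , x<1+v+k) → ℕP.<⇒≤ v<x , ℕP.<-≤-trans x<1+v+k (ℕP.≤-reflexive (sym (ℕP.+-suc v k)))) (All-range (suc v) k)

  range-distinct : ∀ v k → AllPairs _≢_ (range v k)
  range-distinct v zero    = []
  range-distinct v (suc k) = All.map (λ (v<x , _) → ℕP.<⇒≢ v<x) (All-range (suc v) k) ∷ range-distinct (suc v) k

  applyUpTo≡range : ∀ (f : ℕ → ℕ) v k → (∀ i → f i ≡ i + v) → applyUpTo f k ≡ range v k
  applyUpTo≡range f v zero    f≗ = refl
  applyUpTo≡range f v (suc k) f≗ =
    cong₂ _∷_ (f≗ 0) (applyUpTo≡range (f ∘ suc) (suc v) k (λ i → trans (f≗ (suc i)) (sym (ℕP.+-suc i v))))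

  insert-head : ∀ x s → All (x ≤_) s → insert x s ≡ x ∷ s
  insert-head x []      _         = refl
  insert-head x (y ∷ s) (x≤y ∷ _) with x ℕ.≤ᵇ y | ℕP.≤⇒≤ᵇ x≤y
  ... | true | _ = refl

  insert-after : ∀ x y s → y < x → insert x (y ∷ s) ≡ y ∷ insert x s
  insert-after x y s y<x with x ℕ.≤ᵇ y in x≤ᵇy
  ... | true  = ⊥-elim (ℕP.<⇒≱ y<x (ℕP.≤ᵇ⇒≤ x y (subst T (sym x≤ᵇy) tt)))
  ... | false = refl

  insert-after-replicate : ∀ x k v s → v < x → insert x (replicate k v ++ s) ≡ replicate k v ++ insert x s
  insert-after-replicate x zero    v s v<x = refl
  insert-after-replicate x (suc k) v s v<x =
    trans (insert-after x v _ v<x) (cong (v ∷_) (insert-after-replicate x k v s v<x))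

  All-runs : ∀ {u} v c → u ≤ v → All (u ≤_) (runs v c)
  All-runs v []      u≤v = []
  All-runs v (k ∷ c) u≤v = ++⁺ (replicate⁺ k u≤v) (All-runs (suc v) c (ℕP.m≤n⇒m≤1+n u≤v))

  counts-below : ∀ {x} v k π → x < v → counts (range v k) (x ∷ π) ≡ counts (range v k) π
  counts-below v zero    π x<v = refl
  counts-below v (suc k) π x<v =
    cong₂ _∷_ (count-there π (ℕP.>⇒≢ x<v)) (counts-below (suc v) k π (ℕP.m≤n⇒m≤1+n x<v))

  insert-runs : ∀ {x} v k π → InRange v k x → insert x (runs v (counts (range v k) π)) ≡ runs v (counts (range v k) (x ∷ π))
  insert-runs v zero    π (v≤x , x<v+0) = ⊥-elim (ℕP.<⇒≱ x<v+0 (subst (_≤ _) (sym (ℕP.+-identityʳ v)) v≤x))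
  insert-runs {x} v (suc k) π (v≤x , x<v+1+k) with v ℕ.≟ x
  ... | yes refl rewrite counts-below (suc v) k π (ℕP.n<1+n v) =
    insert-head v _ (++⁺ (replicate⁺ (count v π) ℕP.≤-refl) (All-runs (suc v) (counts (range (suc v) k) π) (ℕP.n≤1+n v)))
  ... | no v≢x = trans (insert-after-replicate x (count v π) v _ v<x)
    (cong (replicate (count v π) v ++_) (insert-runs (suc v) k π (v<x , subst (x <_) (ℕP.+-suc v k) x<v+1+k)))
    where
    v<x : v < x
    v<x = ℕP.≤∧≢⇒< v≤x v≢x

  runs-counts-[] : ∀ v k → runs v (counts (range v k) []) ≡ []
  runs-counts-[] v zero    = refl
  runs-counts-[] v (suc k) = runs-counts-[] (suc v) k

  sort≡runs-counts : ∀ v k π → All (InRange v k) π → sort π ≡ runs v (counts (range v k) π)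
  sort≡runs-counts v k []      []             = sym (runs-counts-[] v k)
  sort≡runs-counts v k (x ∷ π) (x∈v+k ∷ π∈v+k) =
    trans (cong (insert x) (sort≡runs-counts v k π π∈v+k)) (insert-runs v k π x∈v+k)

  length-runs : ∀ v c → length (runs v c) ≡ sumℕ c
  length-runs v []      = refl
  length-runs v (k ∷ c) = trans (ListP.length-++ (replicate k v)) (cong₂ _+_ (ListP.length-replicate k) (length-runs (suc v) c))

  sum-replicate : ∀ k v → sumℕ (replicate k v) ≡ k * v
  sum-replicate zero    v = refl
  sum-replicate (suc k) v = cong (v +_) (sum-replicate k v)

  sum-runs-∷ : ∀ v k c → sumℕ (runs v (k ∷ c)) ≡ k * v + sumℕ (runs (suc v) c)
  sum-runs-∷ v k c = trans (sum-++ (replicate k v) _) (cong (_+ _) (sum-replicate k v))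

  sum-counts≡length : ∀ v k π → All (InRange v k) π → sumℕ (counts (range v k) π) ≡ length π
  sum-counts≡length v k π π∈v+k = begin
    sumℕ (counts (range v k) π)          ≡⟨ length-runs v (counts (range v k) π) ⟨
    length (runs v (counts (range v k) π)) ≡⟨ cong length (sort≡runs-counts v k π π∈v+k) ⟨
    length (sort π)                      ≡⟨ ↭-length (sort-↭ π) ⟩
    length π                             ∎

  sum≡sum-runs-counts : ∀ v k π → All (InRange v k) π → sumℕ π ≡ sumℕ (runs v (counts (range v k) π))
  sum≡sum-runs-counts v k π π∈v+k = trans (sym (sum-↭ (sort-↭ π))) (cong sumℕ (sort≡runs-counts v k π π∈v+k))

  Parks : ℕ → List ℕ → Set
  Parks b []      = ⊤
  Parks b (x ∷ s) = x ≤ b × Parks (suc b) s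

  Parks⇔All-zip : ∀ s b L (f : ℕ → ℕ) → length s ≡ L → (∀ i → f i ≡ i + b) →
                  Parks b s ⇔ All (uncurry _≤_) (zip s (applyUpTo f L))
  Parks⇔All-zip []      b L       f _   _  = mk⇔ (λ _ → []) (λ _ → tt)
  Parks⇔All-zip (x ∷ s) b (suc L) f len f≗ = mk⇔
    (λ (x≤b , p) → subst (x ≤_) (sym (f≗ 0)) x≤b ∷ Equivalence.to rest p)
    (λ { (x≤f0 ∷ ps) → subst (x ≤_) (f≗ 0) x≤f0 , Equivalence.from rest ps })
    where
    rest = Parks⇔All-zip s (suc b) L (f ∘ suc) (ℕP.suc-injective len) (λ i → trans (f≗ (suc i)) (sym (ℕP.+-suc i b)))

  Parks-suc : ∀ {b} s → Parks b s → Parks (suc b) s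
  Parks-suc []      _         = tt
  Parks-suc (x ∷ s) (x≤b , p) = ℕP.m≤n⇒m≤1+n x≤b , Parks-suc s p

  Parks-replicate⇔ : ∀ k {v b} s → v ≤ b → Parks b (replicate k v ++ s) ⇔ Parks (k + b) s
  Parks-replicate⇔ zero    s v≤b = mk⇔ (λ p → p) (λ p → p)
  Parks-replicate⇔ (suc k) {v} {b} s v≤b = mk⇔
    (λ (_ , p) → subst (λ b′ → Parks b′ s) (ℕP.+-suc k b) (Equivalence.to rest p))
    (λ p → v≤b , Equivalence.from rest (subst (λ b′ → Parks b′ s) (sym (ℕP.+-suc k b)) p))
    where
    rest = Parks-replicate⇔ k s (ℕP.m≤n⇒m≤1+n v≤b)

  Parks-runs-beyond : ∀ {b} u c → b < u → Parks b (runs u c) → sumℕ c ≡ 0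
  Parks-runs-beyond u []            b<u _         = refl
  Parks-runs-beyond u (zero ∷ c)    b<u p         = Parks-runs-beyond (suc u) c (ℕP.m≤n⇒m≤1+n b<u) p
  Parks-runs-beyond u (suc k ∷ c)   b<u (u≤b , _) = ⊥-elim (ℕP.<⇒≱ b<u u≤b)

  -- Exits h c: the walk from height h with steps cᵢ − 1 stays at heights ≥ 0 and reaches −1 at its last step.
  data Exits : ℕ → List ℕ → Set where
    exit : Exits 0 (0 ∷ [])
    step : ∀ {h x h′ c} → h + x ≡ suc h′ → Exits h′ c → Exits h (x ∷ c)

  area : ∀ {h c} → Exits h c → ℕ
  area exit                 = 0
  area (step {h′ = h′} _ e) = h′ + area e

  Exits-step⁻ : ∀ {h x h′ c} → h + x ≡ suc h′ → Exits h (x ∷ c) → Exits h′ c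
  Exits-step⁻ ()       exit
  Exits-step⁻ {c = c} h+x≡1+h′ (step h+x≡1+h″ e) =
    subst (λ h → Exits h c) (ℕP.suc-injective (trans (sym h+x≡1+h″) h+x≡1+h′)) e

  Exits-step⇔ : ∀ {h x h′ c} → h + x ≡ suc h′ → Exits h′ c ⇔ Exits h (x ∷ c)
  Exits-step⇔ h+x≡1+h′ = mk⇔ (step h+x≡1+h′) (Exits-step⁻ h+x≡1+h′)

  ¬Exits-0∷0∷ : ∀ {y c} → ¬ Exits 0 (0 ∷ y ∷ c)
  ¬Exits-0∷0∷ (step () _)

  Parks-runs⇔Exits-last : ∀ c {v} → sumℕ c ≡ length c → Parks (v + 0) (runs (suc v) c) ⇔ Exits 0 (0 ∷ c)
  Parks-runs⇔Exits-last []          _       = mk⇔ (λ _ → exit) (λ _ → tt)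
  Parks-runs⇔Exits-last (y ∷ c) {v} sum≡len = mk⇔
    (λ p → ⊥-elim (ℕP.1+n≢0 (trans (sym sum≡len)
      (Parks-runs-beyond (suc v) (y ∷ c) (s≤s (ℕP.≤-reflexive (ℕP.+-identityʳ v))) p))))
    (⊥-elim ∘ ¬Exits-0∷0∷)

  -- In Parks (v + h) (runs v c) a run of x cars of value v raises the bound v + h by x and the next value
  -- by one, so the slack h follows the walk of Exits.
  Parks-runs⇔Exits : ∀ c {v h} → suc (h + sumℕ c) ≡ length c → Parks (v + h) (runs v c) ⇔ Exits h c
  Parks-runs⇔Exits [] ()
  Parks-runs⇔Exits (x ∷ c) {v} {h} balanced with h + x in h+x≡
  ... | suc h′ =
    Exits-step⇔ h+x≡ ⇔-∘ (subst (λ b → Parks b (runs (suc v) c) ⇔ Exits h′ c) (sym bound) (Parks-runs⇔Exits c balanced′)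
                     ⇔-∘ Parks-replicate⇔ x (runs (suc v) c) (ℕP.m≤m+n v h))
    where
    bound : x + (v + h) ≡ suc v + h′
    bound = begin
      x + (v + h)   ≡⟨ ℕP.+-comm x (v + h) ⟩
      v + h + x     ≡⟨ ℕP.+-assoc v h x ⟩
      v + (h + x)   ≡⟨ cong (v +_) h+x≡ ⟩
      v + suc h′    ≡⟨ ℕP.+-suc v h′ ⟩
      suc v + h′    ∎
    balanced′ : suc (h′ + sumℕ c) ≡ length c
    balanced′ = ℕP.suc-injective (begin
      suc (suc h′ + sumℕ c)   ≡⟨ cong (λ m → suc (m + sumℕ c)) h+x≡ ⟨
      suc (h + x + sumℕ c)    ≡⟨ cong suc (ℕP.+-assoc h x (sumℕ c)) ⟩
      suc (h + (x + sumℕ c))  ≡⟨ balanced ⟩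
      suc (length c)          ∎)
  ... | zero = subst₂ (λ h x → Parks (v + h) (runs v (x ∷ c)) ⇔ Exits h (x ∷ c)) (sym h≡0) (sym x≡0)
                 (Parks-runs⇔Exits-last c (ℕP.suc-injective (trans (cong suc (sym h+[x+s]≡s)) balanced)))
    where
    h≡0 = ℕP.m+n≡0⇒m≡0 h h+x≡
    x≡0 = ℕP.m+n≡0⇒n≡0 h h+x≡
    h+[x+s]≡s : h + (x + sumℕ c) ≡ sumℕ c
    h+[x+s]≡s = cong₂ (λ a b → a + (b + sumℕ c)) h≡0 x≡0

  length-range : ∀ v k → length (range v k) ≡ k
  length-range v zero    = refl
  length-range v (suc k) = cong suc (length-range (suc v) k)

  length-counts-range : ∀ v k π → length (counts (range v k) π) ≡ k
  length-counts-range v k π = trans (ListP.length-map (λ a → count a π) (range v k)) (length-range v k)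

  isParkingFunction⇔Parks : ∀ k π → All (InRange 1 k) π → IsParkingFunction π ⇔ Parks 1 (runs 1 (counts (range 1 k) π))
  isParkingFunction⇔Parks k π π∈ = mk⇔
    (λ (_ , sorted≤) → subst (Parks 1) sort≡ (Equivalence.from parks⇔ sorted≤))
    (λ p → All.map proj₁ π∈ , Equivalence.to parks⇔ (subst (Parks 1) (sym sort≡) p))
    where
    sort≡ = sort≡runs-counts 1 k π π∈
    parks⇔ = Parks⇔All-zip (sort π) 1 (length π) suc (↭-length (sort-↭ π)) (λ i → sym (ℕP.+-comm i 1))

  isParkingFunction⇔Exits : ∀ {L} π → length π ≡ L → All (InRange 1 (suc L)) π →
                            IsParkingFunction π ⇔ Exits 0 (counts (range 1 (suc L)) π)
  isParkingFunction⇔Exits {L} π len π∈ =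
    Parks-runs⇔Exits (counts (range 1 (suc L)) π) balanced ⇔-∘ isParkingFunction⇔Parks (suc L) π π∈
    where
    balanced : suc (sumℕ (counts (range 1 (suc L)) π)) ≡ length (counts (range 1 (suc L)) π)
    balanced = trans (cong suc (trans (sum-counts≡length 1 (suc L) π π∈) len)) (sym (length-counts-range 1 (suc L) π))

  ∃-lookup≡ : ∀ a π → 0 < count a π → ∃[ i ] lookup π i ≡ a
  ∃-lookup≡ a (x ∷ π) pos with a ℕ.≟ x
  ... | yes a≡x = Fin.zero , sym a≡x
  ... | no  _   with ∃-lookup≡ a π pos
  ...   | i , πᵢ≡a = Fin.suc i , πᵢ≡a

  count-lookup-removeAt : ∀ π i → count (lookup π i) π ≡ suc (count (lookup π i) (removeAt π i))
  count-lookup-removeAt (x ∷ π) Fin.zero    = count-here x π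
  count-lookup-removeAt (x ∷ π) (Fin.suc i) with lookup π i ℕ.≟ x
  ... | yes _ = cong suc (count-lookup-removeAt π i)
  ... | no  _ = count-lookup-removeAt π i

  count-removeAt : ∀ π i {u} → u ≢ lookup π i → count u (removeAt π i) ≡ count u π
  count-removeAt (x ∷ π) Fin.zero    u≢x = sym (count-there π u≢x)
  count-removeAt (x ∷ π) (Fin.suc i) {u} u≢πᵢ with u ℕ.≟ x
  ... | yes _ = cong suc (count-removeAt π i u≢πᵢ)
  ... | no  _ = count-removeAt π i u≢πᵢ

  All-removeAt : ∀ {P : ℕ → Set} π i → All P π → All P (removeAt π i)
  All-removeAt (x ∷ π) Fin.zero    (_  ∷ ps) = ps
  All-removeAt (x ∷ π) (Fin.suc i) (px ∷ ps) = px ∷ All-removeAt π i ps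

  counts-removeAt-1 : ∀ k π i → lookup π i ≡ 1 →
                      counts (range 1 (suc k)) π ≡ suc (count 1 (removeAt π i)) ∷ counts (range 2 k) (removeAt π i)
  counts-removeAt-1 k π i πᵢ≡1 = cong₂ _∷_
    (subst (λ a → count a π ≡ suc (count a (removeAt π i))) πᵢ≡1 (count-lookup-removeAt π i))
    (ListP.map-cong-local (All.map (λ (2≤u , _) → sym (count-removeAt π i (λ u≡πᵢ → ℕP.<⇒≢ 2≤u (sym (trans u≡πᵢ πᵢ≡1)))))
                                   (All-range 2 k)))

  triangle : ℕ → ℕ
  triangle zero    = 0
  triangle (suc k) = suc k + triangle k

  n[1+n]/2≡triangle : ∀ n → (n * suc n) ℕ./ 2 ≡ triangle n
  n[1+n]/2≡triangle n = trans (cong (ℕ._/ 2) (n[1+n]≡triangle*2 n)) (m*n/n≡m (triangle n) 2)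
    where
    n[1+n]≡triangle*2 : ∀ n → n * suc n ≡ triangle n * 2
    n[1+n]≡triangle*2 zero    = refl
    n[1+n]≡triangle*2 (suc n) = begin
      suc n * suc (suc n)             ≡⟨ expand n ⟩
      2 * suc n + n * suc n           ≡⟨ cong (2 * suc n +_) (n[1+n]≡triangle*2 n) ⟩
      2 * suc n + triangle n * 2      ≡⟨ collect n (triangle n) ⟩
      (suc n + triangle n) * 2        ∎
      where
      expand : ∀ n → suc n * suc (suc n) ≡ 2 * suc n + n * suc n
      expand = solve-∀
      collect : ∀ n t → 2 * suc n + t * 2 ≡ (suc n + t) * 2
      collect = solve-∀

  -- For w = h = 0, with runs 1 c the sorted parking function π, this says area e = L(L + 1)/2 − Σ π = dis π.
  area-invariant : ∀ {h c} (e : Exits h c) w L → suc w + length c ≡ suc (suc L) →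
                   area e + sumℕ (runs (suc w) c) + suc w * h + triangle w ≡ triangle L
  area-invariant exit w L len = trans (cong (_+ triangle w) (ℕP.*-zeroʳ (suc w))) (cong triangle w≡L)
    where
    w≡L : w ≡ L
    w≡L = ℕP.suc-injective (trans (ℕP.+-comm 1 w) (ℕP.suc-injective len))
  area-invariant (step {h} {x} {h′} {c} h+x≡1+h′ e) w L len = begin
    h′ + a + sumℕ (runs (suc w) (x ∷ c)) + suc w * h + triangle w
      ≡⟨ cong (λ s → h′ + a + s + suc w * h + triangle w) (sum-runs-∷ (suc w) x c) ⟩
    h′ + a + (x * suc w + R) + suc w * h + triangle w     ≡⟨ regroup h′ a x w R h (triangle w) ⟩
    a + R + h′ + suc w * (h + x) + triangle w             ≡⟨ cong (λ m → a + R + h′ + suc w * m + triangle w) h+x≡1+h′ ⟩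
    a + R + h′ + suc w * suc h′ + triangle w              ≡⟨ regroup′ a R h′ w (triangle w) ⟩
    a + R + suc (suc w) * h′ + triangle (suc w)           ≡⟨ area-invariant e (suc w) L (trans (sym (ℕP.+-suc (suc w) (length c))) len) ⟩
    triangle L                                            ∎
    where
    a = area e
    R = sumℕ (runs (suc (suc w)) c)
    regroup : ∀ h′ a x w R h t → h′ + a + (x * suc w + R) + suc w * h + t ≡ a + R + h′ + suc w * (h + x) + t
    regroup = solve-∀
    regroup′ : ∀ a R h′ w t → a + R + h′ + suc w * suc h′ + t ≡ a + R + suc (suc w) * h′ + (suc w + t)
    regroup′ = solve-∀

  -- Prime parking functions

  module _ (n : ℕ) (π : List ℕ) (len : length π ≡ suc n) (π∈ : All (InRange 1 (suc n)) π) where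

    private
      rest = counts (range 2 n) π

      sum-counts : count 1 π + sumℕ rest ≡ suc n
      sum-counts = trans (sum-counts≡length 1 (suc n) π π∈) len

      length-rest : length rest ≡ n
      length-rest = length-counts-range 2 n π

      removeAt-1 : ∀ i → lookup π i ≡ 1 → count 1 π ≡ suc (count 1 (removeAt π i)) ×
                                          counts (range 1 (suc n)) (removeAt π i) ≡ count 1 (removeAt π i) ∷ rest
      removeAt-1 i πᵢ≡1 = ListP.∷-injectiveˡ eq , cong (_ ∷_) (sym (ListP.∷-injectiveʳ eq))
        where eq = counts-removeAt-1 n π i πᵢ≡1

      removeAt-isParkingFunction⇔ : ∀ i → IsParkingFunction (removeAt π i) ⇔ Exits 0 (counts (range 1 (suc n)) (removeAt π i))
      removeAt-isParkingFunction⇔ i = isParkingFunction⇔Exits (removeAt π i)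
        (ℕP.suc-injective (trans (sym (ListP.length-removeAt′ π i)) len)) (All-removeAt π i π∈)

      count-1-positive : IsParkingFunction π → 0 < count 1 π
      count-1-positive pf with count 1 π in c₁≡ | Equivalence.to (isParkingFunction⇔Parks (suc n) π π∈) pf
      ... | suc _ | _ = s≤s z≤n
      ... | zero  | p = ⊥-elim (ℕP.1+n≢0 (trans (sym sum-counts) (trans (cong (_+ sumℕ rest) c₁≡)
                          (Parks-runs-beyond 2 rest (s≤s (s≤s z≤n)) p))))

    isPrimePF⇔ : IsPrimePF (suc n) π ⇔ (∃[ c₁ ] count 1 π ≡ suc c₁ × Exits 0 (c₁ ∷ rest))
    isPrimePF⇔ = mk⇔ to from
      where
      to : IsPrimePF (suc n) π → ∃[ c₁ ] count 1 π ≡ suc c₁ × Exits 0 (c₁ ∷ rest)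
      to (_ , pf , prime) with ∃-lookup≡ 1 π (count-1-positive pf)
      ... | i , πᵢ≡1 = count 1 (removeAt π i) , proj₁ (removeAt-1 i πᵢ≡1) ,
        subst (Exits 0) (proj₂ (removeAt-1 i πᵢ≡1)) (Equivalence.to (removeAt-isParkingFunction⇔ i) (prime i πᵢ≡1))
      from : ∃[ c₁ ] count 1 π ≡ suc c₁ × Exits 0 (c₁ ∷ rest) → IsPrimePF (suc n) π
      from (c₁ , c≡ , e) = len , Equivalence.from (isParkingFunction⇔Parks (suc n) π π∈) parks , prime
        where
        balanced : suc (c₁ + sumℕ rest) ≡ suc (length rest)
        balanced = trans (trans (cong (_+ sumℕ rest) (sym c≡)) sum-counts) (cong suc (sym length-rest))
        parks : Parks 1 (runs 1 (count 1 π ∷ rest))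
        parks = subst (λ c → Parks 1 (runs 1 (c ∷ rest))) (sym c≡)
          (ℕP.≤-refl , Parks-suc _ (Equivalence.from (Parks-runs⇔Exits (c₁ ∷ rest) {1} {0} balanced) e))
        prime : ∀ i → lookup π i ≡ 1 → IsParkingFunction (removeAt π i)
        prime i πᵢ≡1 = Equivalence.from (removeAt-isParkingFunction⇔ i)
          (subst (Exits 0) (trans c₁≡ (sym (proj₂ (removeAt-1 i πᵢ≡1)))) e)
          where
          c₁≡ : c₁ ∷ rest ≡ count 1 (removeAt π i) ∷ rest
          c₁≡ = cong (_∷ rest) (ℕP.suc-injective (trans (sym c≡) (proj₁ (removeAt-1 i πᵢ≡1))))

    dis≡n+area : ∀ {c₁} → count 1 π ≡ suc c₁ → (e : Exits 0 (c₁ ∷ rest)) → dis π ≡ n + area e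
    dis≡n+area {c₁} c≡ e = begin
      (length π * suc (length π)) ℕ./ 2 ∸ sumℕ π    ≡⟨ cong (λ l → (l * suc l) ℕ./ 2 ∸ sumℕ π) len ⟩
      (suc n * suc (suc n)) ℕ./ 2 ∸ sumℕ π          ≡⟨ cong (_∸ sumℕ π) (n[1+n]/2≡triangle (suc n)) ⟩
      suc n + triangle n ∸ sumℕ π                   ≡⟨ cong₂ (λ t s → suc n + t ∸ s) (sym area≡) sum≡ ⟩
      suc n + (area e + S) ∸ suc S                  ≡⟨ cong (_∸ suc S) (regroup n (area e) S) ⟩
      suc S + (n + area e) ∸ suc S                  ≡⟨ ℕP.m+n∸m≡n (suc S) (n + area e) ⟩
      n + area e                                    ∎
      where
      S = sumℕ (runs 1 (c₁ ∷ rest))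
      sum≡ : sumℕ π ≡ suc S
      sum≡ = trans (sum≡sum-runs-counts 1 (suc n) π π∈) (cong (λ c → sumℕ (runs 1 (c ∷ rest))) c≡)
      area≡ : area e + S ≡ triangle n
      area≡ = trans (sym (trans (ℕP.+-identityʳ _) (ℕP.+-identityʳ _))) (area-invariant e 0 n (cong (2 +_) length-rest))
      regroup : ∀ n a S → suc n + (a + S) ≡ suc S + (n + a)
      regroup = solve-∀

-- Weighted walks and Łukasiewicz paths

module _ where
  open import Data.Rational using (_+_; _*_)
  open import Data.Integer using (+_; -[1+_]; -≤-; -≤+; +≤+)

  mutual
    exitWeight : ℚ → ℕ → List ℕ → ℚ
    exitWeight q h []      = 0ℚ
    exitWeight q h (x ∷ c) = weightAfterStep q (h ℕ.+ x) c

    -- the first argument is the height reached by the step, plus one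
    weightAfterStep : ℚ → ℕ → List ℕ → ℚ
    weightAfterStep q zero    []      = 1ℚ
    weightAfterStep q zero    (_ ∷ _) = 0ℚ
    weightAfterStep q (suc h) c       = q ^ℚ h * exitWeight q h c

  exitWeight-area : ∀ q {h c} (e : Exits h c) → exitWeight q h c ≡ q ^ℚ area e
  exitWeight-area q exit = refl
  exitWeight-area q (step {h} {x} {h′} {c} h+x≡1+h′ e) = begin
    weightAfterStep q (h ℕ.+ x) c   ≡⟨ cong (λ t → weightAfterStep q t c) h+x≡1+h′ ⟩
    q ^ℚ h′ * exitWeight q h′ c     ≡⟨ cong (q ^ℚ h′ *_) (exitWeight-area q e) ⟩
    q ^ℚ h′ * q ^ℚ area e           ≡⟨ ^ℚ-distribˡ-+-* q h′ (area e) ⟨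
    q ^ℚ (h′ ℕ.+ area e)            ∎

  Exits-last : ∀ {h x} → h ℕ.+ x ≡ 0 → Exits h (x ∷ [])
  Exits-last {zero} {zero} _ = exit

  exitWeight-¬Exits : ∀ q {h} c → ¬ Exits h c → exitWeight q h c ≡ 0ℚ
  exitWeight-¬Exits q []          _  = refl
  exitWeight-¬Exits q {h} (x ∷ c) ¬e with h ℕ.+ x in h+x≡
  exitWeight-¬Exits q (x ∷ [])    ¬e | zero   = ⊥-elim (¬e (Exits-last h+x≡))
  exitWeight-¬Exits q (x ∷ _ ∷ _) ¬e | zero   = refl
  exitWeight-¬Exits q (x ∷ c)     ¬e | suc h′ =
    trans (cong (q ^ℚ h′ *_) (exitWeight-¬Exits q c (¬e ∘ step h+x≡))) (ℚP.*-zeroʳ (q ^ℚ h′))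

  ppfWeight : ℚ → ℕ → List ℕ → ℚ
  ppfWeight q n (suc c₁ ∷ c) = q ^ℚ n * exitWeight q 0 (c₁ ∷ c)
  ppfWeight q n _            = 0ℚ

  keepIf-isPrimePF≡ppfWeight : ∀ q n π → length π ≡ suc n → All (InRange 1 (suc n)) π →
    keepIf (isPrimePF? (suc n) π) (q ^ℚ dis π) ≡ ppfWeight q n (counts (range 1 (suc n)) π)
  keepIf-isPrimePF≡ppfWeight q n π len π∈ with isPrimePF? (suc n) π
  ... | yes ppf with Equivalence.to (isPrimePF⇔ n π len π∈) ppf
  ...   | c₁ , c≡ , e = begin
    q ^ℚ dis π                               ≡⟨ cong (q ^ℚ_) (dis≡n+area n π len π∈ c≡ e) ⟩
    q ^ℚ (n ℕ.+ area e)                      ≡⟨ ^ℚ-distribˡ-+-* q n (area e) ⟩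
    q ^ℚ n * q ^ℚ area e                     ≡⟨ cong (q ^ℚ n *_) (exitWeight-area q e) ⟨
    ppfWeight q n (suc c₁ ∷ rest)            ≡⟨ cong (λ c → ppfWeight q n (c ∷ rest)) c≡ ⟨
    ppfWeight q n (count 1 π ∷ rest)         ∎
    where
    rest = counts (range 2 n) π
  keepIf-isPrimePF≡ppfWeight q n π len π∈ | no ¬ppf with count 1 π in c≡
  ... | zero   = refl
  ... | suc c₁ =
    sym (trans (cong (q ^ℚ n *_) (exitWeight-¬Exits q (c₁ ∷ counts (range 2 n) π) ¬e)) (ℚP.*-zeroʳ (q ^ℚ n)))
    where
    ¬e : ¬ Exits 0 (c₁ ∷ counts (range 2 n) π)
    ¬e e = ¬ppf (Equivalence.from (isPrimePF⇔ n π len π∈) (c₁ , c≡ , e))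

  IsŁukasiewiczFrom : ℤ → List ℤ → Set
  IsŁukasiewiczFrom s ℓ = All (ℤ.-1ℤ ℤ.≤_) ℓ × All (+ 0 ℤ.≤_) (partialSums s ℓ) × s ℤ.+ sumℤ ℓ ≡ + 0

  isŁukasiewiczFrom? : ∀ s ℓ → Dec (IsŁukasiewiczFrom s ℓ)
  isŁukasiewiczFrom? s ℓ =
    all? (ℤ.-1ℤ ℤ.≤?_) ℓ ×-dec (all? (+ 0 ℤ.≤?_) (partialSums s ℓ) ×-dec (s ℤ.+ sumℤ ℓ ℤ.≟ + 0))

  ValidStep : ℤ → ℤ → Set
  ValidStep s y = ℤ.-1ℤ ℤ.≤ y × + 0 ℤ.≤ s ℤ.+ y

  validStep? : ∀ s y → Dec (ValidStep s y)
  validStep? s y = (ℤ.-1ℤ ℤ.≤? y) ×-dec (+ 0 ℤ.≤? s ℤ.+ y)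

  IsŁukasiewiczFrom-∷⇔ : ∀ s y ℓ → IsŁukasiewiczFrom s (y ∷ ℓ) ⇔ (ValidStep s y × IsŁukasiewiczFrom (s ℤ.+ y) ℓ)
  IsŁukasiewiczFrom-∷⇔ s y ℓ = mk⇔
    (λ { (y≥ ∷ ys≥ , h≥ ∷ hs≥ , end) → (y≥ , h≥) , ys≥ , hs≥ , trans (ℤP.+-assoc s y (sumℤ ℓ)) end })
    (λ { ((y≥ , h≥) , ys≥ , hs≥ , end) → y≥ ∷ ys≥ , h≥ ∷ hs≥ , trans (sym (ℤP.+-assoc s y (sumℤ ℓ))) end })

  pathWeightFrom : ℚ → ℤ → List ℤ → ℚ
  pathWeightFrom q s ℓ = prodℚ (map (uncurry (stepWeight q)) (zip ℓ (partialSums s ℓ)))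

  łukasiewiczWeight : ℚ → ℤ → List ℤ → ℚ
  łukasiewiczWeight q s ℓ = keepIf (isŁukasiewiczFrom? s ℓ) (pathWeightFrom q s ℓ)

  łukasiewiczWeight-∷ : ∀ q s y ℓ → łukasiewiczWeight q s (y ∷ ℓ) ≡
                        keepIf (validStep? s y) (stepWeight q y (s ℤ.+ y) * łukasiewiczWeight q (s ℤ.+ y) ℓ)
  łukasiewiczWeight-∷ q s y ℓ = trans
    (keepIf-cong (isŁukasiewiczFrom? s (y ∷ ℓ)) (validStep? s y ×-dec isŁukasiewiczFrom? (s ℤ.+ y) ℓ)
                 (IsŁukasiewiczFrom-∷⇔ s y ℓ) (a * b))
    (keepIf-×-dec (validStep? s y) (isŁukasiewiczFrom? (s ℤ.+ y) ℓ) a b)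
    where
    a = stepWeight q y (s ℤ.+ y)
    b = pathWeightFrom q (s ℤ.+ y) ℓ

  pathSum : ℚ → ℕ → ℕ → ℤ → ℚ
  pathSum q n k s = ∑[ ℓ ∈ words (stepRange n) k ] łukasiewiczWeight q s ℓ

  -- paths whose first step has size x − 1 and reaches height t − 1
  afterFirstStep : ℚ → ℕ → ℕ → ℕ → ℕ → ℚ
  afterFirstStep q n k zero     x = 0ℚ
  afterFirstStep q n k (suc h′) x = q ^ℚ h′ * invFact x * pathSum q n k (+ h′)

  sumOver-stepRange : ∀ n (g : ℤ → ℚ) → (∑[ y ∈ stepRange n ] g y) ≡ (∑[ x < suc n ] g (+ x ℤ.- ℤ.1ℤ))
  sumOver-stepRange n g = begin
    (∑[ y ∈ stepRange n ] g y)                       ≡⟨ sumOver-map g (ℤ._- ℤ.1ℤ) (map +_ (upTo (suc n))) ⟩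
    (∑[ k ∈ map +_ (upTo (suc n)) ] g (k ℤ.- ℤ.1ℤ))  ≡⟨ sumOver-map (λ k → g (k ℤ.- ℤ.1ℤ)) +_ (upTo (suc n)) ⟩
    (∑[ x ∈ upTo (suc n) ] g (+ x ℤ.- ℤ.1ℤ))         ≡⟨ sumOver-applyUpTo (λ x → g (+ x ℤ.- ℤ.1ℤ)) (λ x → x) (suc n) ⟩
    (∑[ x < suc n ] g (+ x ℤ.- ℤ.1ℤ))                ∎

  sumOver-firstStep : ∀ q n k h x →
    (∑[ ℓ ∈ words (stepRange n) k ] łukasiewiczWeight q (+ h) ((+ x ℤ.- ℤ.1ℤ) ∷ ℓ)) ≡ afterFirstStep q n k (h ℕ.+ x) x
  sumOver-firstStep q n k zero zero =
    trans (sumOver-cong (λ ℓ → łukasiewiczWeight-∷ q (+ 0) -[1+ 0 ] ℓ) (words (stepRange n) k)) (sumOver-0 (words (stepRange n) k))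
  sumOver-firstStep q n k (suc h) zero = begin
    (∑[ ℓ ∈ W ] łukasiewiczWeight q (+ suc h) (-[1+ 0 ] ∷ ℓ))
      ≡⟨ sumOver-cong (λ ℓ → trans (łukasiewiczWeight-∷ q (+ suc h) -[1+ 0 ] ℓ)
                                   (keepIf-yes (validStep? (+ suc h) -[1+ 0 ]) (-≤- z≤n , +≤+ z≤n) _)) W ⟩
    (∑[ ℓ ∈ W ] q ^ℚ h * invFact 0 * łukasiewiczWeight q (+ h) ℓ)
      ≡⟨ *-distribˡ-sumOver (q ^ℚ h * invFact 0) (łukasiewiczWeight q (+ h)) W ⟨
    q ^ℚ h * invFact 0 * pathSum q n k (+ h)
      ≡⟨ cong (λ t → afterFirstStep q n k (suc t) 0) (ℕP.+-identityʳ h) ⟨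
    afterFirstStep q n k (suc h ℕ.+ 0) 0 ∎
    where W = words (stepRange n) k
  sumOver-firstStep q n k h (suc x) = begin
    (∑[ ℓ ∈ W ] łukasiewiczWeight q (+ h) (+ x ∷ ℓ))
      ≡⟨ sumOver-cong (λ ℓ → trans (łukasiewiczWeight-∷ q (+ h) (+ x) ℓ)
                                   (keepIf-yes (validStep? (+ h) (+ x)) (-≤+ , +≤+ z≤n) _)) W ⟩
    (∑[ ℓ ∈ W ] q ^ℚ (h ℕ.+ x) * invFact (x ℕ.+ 1) * łukasiewiczWeight q (+ (h ℕ.+ x)) ℓ)
      ≡⟨ *-distribˡ-sumOver (q ^ℚ (h ℕ.+ x) * invFact (x ℕ.+ 1)) (łukasiewiczWeight q (+ (h ℕ.+ x))) W ⟨
    q ^ℚ (h ℕ.+ x) * invFact (x ℕ.+ 1) * pathSum q n k (+ (h ℕ.+ x))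
      ≡⟨ cong (λ m → q ^ℚ (h ℕ.+ x) * invFact m * pathSum q n k (+ (h ℕ.+ x))) (ℕP.+-comm x 1) ⟩
    afterFirstStep q n k (suc (h ℕ.+ x)) (suc x)
      ≡⟨ cong (λ t → afterFirstStep q n k t (suc x)) (ℕP.+-suc h x) ⟨
    afterFirstStep q n k (h ℕ.+ suc x) (suc x) ∎
    where W = words (stepRange n) k

  pathSum-suc : ∀ q n k h → pathSum q n (suc k) (+ h) ≡ (∑[ x < suc n ] afterFirstStep q n k (h ℕ.+ x) x)
  pathSum-suc q n k h = begin
    pathSum q n (suc k) (+ h)
      ≡⟨ sumOver-words-suc (łukasiewiczWeight q (+ h)) (stepRange n) k ⟩
    (∑[ y ∈ stepRange n ] ∑[ ℓ ∈ words (stepRange n) k ] łukasiewiczWeight q (+ h) (y ∷ ℓ))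
      ≡⟨ sumOver-stepRange n (λ y → ∑[ ℓ ∈ words (stepRange n) k ] łukasiewiczWeight q (+ h) (y ∷ ℓ)) ⟩
    (∑[ x < suc n ] ∑[ ℓ ∈ words (stepRange n) k ] łukasiewiczWeight q (+ h) ((+ x ℤ.- ℤ.1ℤ) ∷ ℓ))
      ≡⟨ sumBelow-cong (suc n) (λ {x} _ → sumOver-firstStep q n k h x) ⟩
    (∑[ x < suc n ] afterFirstStep q n k (h ℕ.+ x) x) ∎

  afterFirstStep-vanishes : ∀ {q n k} t x → (∀ {h′} → t ≡ suc h′ → pathSum q n k (+ h′) ≡ 0ℚ) →
                            afterFirstStep q n k t x ≡ 0ℚ
  afterFirstStep-vanishes     zero     x _      = refl
  afterFirstStep-vanishes {q} (suc h′) x vanish =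
    trans (cong (q ^ℚ h′ * invFact x *_) (vanish refl)) (ℚP.*-zeroʳ (q ^ℚ h′ * invFact x))

  pathSum-vanishes : ∀ q n k h → k < h → pathSum q n k (+ h) ≡ 0ℚ
  pathSum-vanishes q n zero    h 0<h = cong (_+ 0ℚ) (keepIf-no (isŁukasiewiczFrom? (+ h) []) ¬end 1ℚ)
    where
    ¬end : ¬ IsŁukasiewiczFrom (+ h) []
    ¬end (_ , _ , end) = ℕP.<⇒≢ 0<h (sym (trans (sym (ℕP.+-identityʳ h)) (ℤP.+-injective end)))
  pathSum-vanishes q n (suc k) h k<h = trans (pathSum-suc q n k h) (sumBelow-zero (suc n) λ {x} _ →
    afterFirstStep-vanishes {q} {n} {k} (h ℕ.+ x) x λ {h′} h+x≡1+h′ →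
      pathSum-vanishes q n k h′ (ℕP.≤-pred (ℕP.≤-trans k<h (subst (h ≤_) h+x≡1+h′ (ℕP.m≤m+n h x)))))

  multinomialSum-weightAfterStep : ∀ q n k M x t →
    (∀ {h′} → t ≡ suc h′ → multinomialSum (suc k) M (exitWeight q h′) ≡ pathSum q n k (+ h′)) →
    invFact x * multinomialSum (suc k) M (weightAfterStep q t) ≡ afterFirstStep q n k t x
  multinomialSum-weightAfterStep q n k M x zero _ = begin
    invFact x * multinomialSum (suc k) M (weightAfterStep q 0)  ≡⟨ cong (invFact x *_) (multinomialSum-congLength (suc k) M nonempty) ⟩
    invFact x * multinomialSum (suc k) M (λ _ → 0ℚ)             ≡⟨ cong (invFact x *_) (multinomialSum-zero (suc k) M) ⟩
    invFact x * 0ℚ                                              ≡⟨ ℚP.*-zeroʳ (invFact x) ⟩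
    0ℚ                                                          ∎
    where
    nonempty : ∀ c → length c ≡ suc k → weightAfterStep q 0 c ≡ 0ℚ
    nonempty (_ ∷ _) _ = refl
  multinomialSum-weightAfterStep q n k M x (suc h′) paths = begin
    invFact x * multinomialSum (suc k) M (λ c → q ^ℚ h′ * exitWeight q h′ c)
      ≡⟨ cong (invFact x *_) (*-distribˡ-multinomialSum (suc k) M (q ^ℚ h′) (exitWeight q h′)) ⟨
    invFact x * (q ^ℚ h′ * multinomialSum (suc k) M (exitWeight q h′))
      ≡⟨ cong (λ t → invFact x * (q ^ℚ h′ * t)) (paths refl) ⟩
    invFact x * (q ^ℚ h′ * pathSum q n k (+ h′))
      ≡⟨ solve 3 (λ i a p → i :* (a :* p) := a :* i :* p) refl (invFact x) (q ^ℚ h′) (pathSum q n k (+ h′)) ⟩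
    q ^ℚ h′ * invFact x * pathSum q n k (+ h′) ∎
    where open +-*-Solver

  multinomialSum-exitWeight : ∀ q n k {h N} → N ℕ.+ h ≡ k → k < n →
                              multinomialSum (suc k) N (exitWeight q h) ≡ pathSum q n k (+ h)
  multinomialSum-exitWeight q n zero    {zero} {zero} refl _ = refl
  multinomialSum-exitWeight q n (suc k) {h} {N} N+h≡1+k 1+k<n = begin
    (∑[ x < suc N ] invFact x * multinomialSum (suc k) (N ∸ x) (weightAfterStep q (h ℕ.+ x)))
      ≡⟨ sumBelow-cong (suc N) (λ {x} x<1+N → multinomialSum-weightAfterStep q n k (N ∸ x) x (h ℕ.+ x)
           (λ h+x≡1+h′ → multinomialSum-exitWeight q n k (remaining x (ℕP.≤-pred x<1+N) h+x≡1+h′)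
                                                        (ℕP.<-trans (ℕP.n<1+n k) 1+k<n))) ⟩
    (∑[ x < suc N ] afterFirstStep q n k (h ℕ.+ x) x)
      ≡⟨ sumBelow-truncate (suc N) (suc n) (s≤s N≤n) (λ {x} 1+N≤x → afterFirstStep-vanishes {q} {n} {k} (h ℕ.+ x) x
           (λ h+x≡1+h′ → pathSum-vanishes q n k _ (tooHigh 1+N≤x h+x≡1+h′))) ⟨
    (∑[ x < suc n ] afterFirstStep q n k (h ℕ.+ x) x)
      ≡⟨ pathSum-suc q n k h ⟨
    pathSum q n (suc k) (+ h) ∎
    where
    N≤n : N ≤ n
    N≤n = ℕP.≤-trans (ℕP.m≤m+n N h) (ℕP.≤-trans (ℕP.≤-reflexive N+h≡1+k) (ℕP.<⇒≤ 1+k<n))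
    remaining : ∀ x {h′} → x ≤ N → h ℕ.+ x ≡ suc h′ → N ∸ x ℕ.+ h′ ≡ k
    remaining x {h′} x≤N h+x≡1+h′ = ℕP.suc-injective (begin
      suc (N ∸ x ℕ.+ h′)        ≡⟨ ℕP.+-suc (N ∸ x) h′ ⟨
      N ∸ x ℕ.+ suc h′          ≡⟨ cong (N ∸ x ℕ.+_) (trans (sym h+x≡1+h′) (ℕP.+-comm h x)) ⟩
      N ∸ x ℕ.+ (x ℕ.+ h)       ≡⟨ ℕP.+-assoc (N ∸ x) x h ⟨
      N ∸ x ℕ.+ x ℕ.+ h         ≡⟨ cong (ℕ._+ h) (ℕP.m∸n+n≡m x≤N) ⟩
      N ℕ.+ h                   ≡⟨ N+h≡1+k ⟩
      suc k                     ∎)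
    tooHigh : ∀ {x h′} → suc N ≤ x → h ℕ.+ x ≡ suc h′ → k < h′
    tooHigh {x} 1+N≤x h+x≡1+h′ = ℕP.≤-pred (ℕP.≤-trans (s≤s (ℕP.≤-reflexive (sym N+h≡1+k)))
      (subst (suc (N ℕ.+ h) ≤_) (trans (ℕP.+-comm x h) h+x≡1+h′) (ℕP.+-monoˡ-≤ h 1+N≤x)))

  PPFpoly≡multinomialSum : ∀ q n → PPFpoly (suc n) q ≡ fromℕ (suc n !) * multinomialSum (suc n) (suc n) (ppfWeight q n)
  PPFpoly≡multinomialSum q n = begin
    (∑[ π ∈ filter (isPrimePF? m) (seqs m m) ] q ^ℚ dis π)
      ≡⟨ sumOver-filter (isPrimePF? m) (λ π → q ^ℚ dis π) (seqs m m) ⟩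
    (∑[ π ∈ seqs m m ] keepIf (isPrimePF? m π) (q ^ℚ dis π))
      ≡⟨ cong (λ W → ∑[ π ∈ W ] keepIf (isPrimePF? m π) (q ^ℚ dis π)) seqs≡ ⟩
    (∑[ π ∈ words (range 1 m) m ] keepIf (isPrimePF? m π) (q ^ℚ dis π))
      ≡⟨ sumOver-congAll (λ {π} (len , π∈) → keepIf-isPrimePF≡ppfWeight q n π len π∈) (All-words m (All-range 1 m)) ⟩
    (∑[ π ∈ words (range 1 m) m ] ppfWeight q n (counts (range 1 m) π))
      ≡⟨ sumOver-counts≡multinomialSum (range-distinct 1 m) m (ppfWeight q n) ⟩
    fromℕ (m !) * multinomialSum (length (range 1 m)) m (ppfWeight q n)
      ≡⟨ cong (λ r → fromℕ (m !) * multinomialSum r m (ppfWeight q n)) (length-range 1 m) ⟩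
    fromℕ (m !) * multinomialSum m m (ppfWeight q n) ∎
    where
    m = suc n
    seqs≡ : seqs m m ≡ words (range 1 m) m
    seqs≡ = trans (seqs≡words m m) (cong (λ A → words A m) (applyUpTo≡range suc 1 m (λ i → sym (ℕP.+-comm i 1))))

  firstFactor-step : ∀ x ℓ → firstFactor ((+ x ℤ.- ℤ.1ℤ) ∷ ℓ) ≡ (+ 1) / suc x
  firstFactor-step zero    ℓ = refl
  firstFactor-step (suc x) ℓ = cong (λ m → (+ 1) / suc m) (ℕP.+-comm x 1)

  multinomialSum-ppfWeight-byFirstStep : ∀ q n′ → let n = suc n′ in
    multinomialSum (suc n) (suc n) (ppfWeight q n) ≡ q ^ℚ n * (∑[ x < suc n ] (+ 1) / suc x * afterFirstStep q n n′ x x)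
  multinomialSum-ppfWeight-byFirstStep q n′ = begin
    invFact 0 * multinomialSum n (suc n) (λ _ → 0ℚ) + (∑[ x < suc n ] summand x)
      ≡⟨ cong (λ t → invFact 0 * t + (∑[ x < suc n ] summand x)) (multinomialSum-zero n (suc n)) ⟩
    invFact 0 * 0ℚ + (∑[ x < suc n ] summand x)
      ≡⟨ ℚP.+-identityˡ (∑[ x < suc n ] summand x) ⟩
    (∑[ x < suc n ] summand x)
      ≡⟨ sumBelow-cong (suc n) (λ {x} x<1+n → term x (ℕP.≤-pred x<1+n)) ⟩
    (∑[ x < suc n ] q ^ℚ n * ((+ 1) / suc x * afterFirstStep q n n′ x x))
      ≡⟨ *-distribˡ-sumBelow (q ^ℚ n) (λ x → (+ 1) / suc x * afterFirstStep q n n′ x x) (suc n) ⟨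
    q ^ℚ n * (∑[ x < suc n ] (+ 1) / suc x * afterFirstStep q n n′ x x) ∎
    where
    open +-*-Solver
    n = suc n′
    summand : ℕ → ℚ
    summand x = invFact (suc x) * multinomialSum n (n ∸ x) (λ c → q ^ℚ n * exitWeight q 0 (x ∷ c))
    term : ∀ x → x ≤ n → summand x ≡ q ^ℚ n * ((+ 1) / suc x * afterFirstStep q n n′ x x)
    term x x≤n = begin
      invFact (suc x) * multinomialSum n (n ∸ x) (λ c → q ^ℚ n * weightAfterStep q x c)
        ≡⟨ cong₂ _*_ (sym (invFact-suc x)) (sym (*-distribˡ-multinomialSum n (n ∸ x) (q ^ℚ n) (weightAfterStep q x))) ⟩
      (+ 1) / suc x * invFact x * (q ^ℚ n * M)
        ≡⟨ solve 4 (λ a i Q m → a :* i :* (Q :* m) := Q :* (a :* (i :* m))) refl ((+ 1) / suc x) (invFact x) (q ^ℚ n) M ⟩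
      q ^ℚ n * ((+ 1) / suc x * (invFact x * M))
        ≡⟨ cong (λ t → q ^ℚ n * ((+ 1) / suc x * t)) (multinomialSum-weightAfterStep q n n′ (n ∸ x) x x
             (λ x≡1+h′ → multinomialSum-exitWeight q n n′ (remaining x≡1+h′) (ℕP.n<1+n n′))) ⟩
      q ^ℚ n * ((+ 1) / suc x * afterFirstStep q n n′ x x) ∎
      where
      M = multinomialSum n (n ∸ x) (weightAfterStep q x)
      remaining : ∀ {h′} → x ≡ suc h′ → n ∸ x ℕ.+ h′ ≡ n′
      remaining refl = ℕP.m∸n+n≡m (ℕP.≤-pred x≤n)

  keepIf-isŁukasiewicz : ∀ q n ℓ → length ℓ ≡ n →
    keepIf (isŁukasiewicz? n ℓ) (pathWeight q ℓ) ≡ firstFactor ℓ * łukasiewiczWeight q (+ 0) ℓ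
  keepIf-isŁukasiewicz q n ℓ len = trans
    (keepIf-cong (isŁukasiewicz? n ℓ) (isŁukasiewiczFrom? (+ 0) ℓ) (mk⇔
      (λ (_ , steps , heights , end) → steps , heights , trans (ℤP.+-identityˡ (sumℤ ℓ)) end)
      (λ (steps , heights , end) → len , steps , heights , trans (sym (ℤP.+-identityˡ (sumℤ ℓ))) end))
      (pathWeight q ℓ))
    (keepIf-*ˡ (isŁukasiewiczFrom? (+ 0) ℓ) (firstFactor ℓ) (pathWeightFrom q (+ 0) ℓ))

  sumOver-Łuk-byFirstStep : ∀ q n′ → let n = suc n′ in
    (∑[ ℓ ∈ Łuk n ] pathWeight q ℓ) ≡ (∑[ x < suc n ] (+ 1) / suc x * afterFirstStep q n n′ x x)
  sumOver-Łuk-byFirstStep q n′ = begin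
    (∑[ ℓ ∈ filter (isŁukasiewicz? n) (wordsℤ R n) ] pathWeight q ℓ)
      ≡⟨ sumOver-filter (isŁukasiewicz? n) (pathWeight q) (wordsℤ R n) ⟩
    (∑[ ℓ ∈ wordsℤ R n ] keepIf (isŁukasiewicz? n ℓ) (pathWeight q ℓ))
      ≡⟨ cong (λ W → ∑[ ℓ ∈ W ] keepIf (isŁukasiewicz? n ℓ) (pathWeight q ℓ)) (wordsℤ≡words R n) ⟩
    (∑[ ℓ ∈ words R n ] keepIf (isŁukasiewicz? n ℓ) (pathWeight q ℓ))
      ≡⟨ sumOver-congAll (λ {ℓ} (len , _) → keepIf-isŁukasiewicz q n ℓ len) (All-words {P = λ _ → ⊤} n (All.universal _ R)) ⟩
    (∑[ ℓ ∈ words R n ] firstFactor ℓ * łukasiewiczWeight q (+ 0) ℓ)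
      ≡⟨ sumOver-words-suc (λ ℓ → firstFactor ℓ * łukasiewiczWeight q (+ 0) ℓ) R n′ ⟩
    (∑[ y ∈ R ] ∑[ ℓ ∈ W ] firstFactor (y ∷ ℓ) * łukasiewiczWeight q (+ 0) (y ∷ ℓ))
      ≡⟨ sumOver-stepRange n (λ y → ∑[ ℓ ∈ W ] firstFactor (y ∷ ℓ) * łukasiewiczWeight q (+ 0) (y ∷ ℓ)) ⟩
    (∑[ x < suc n ] ∑[ ℓ ∈ W ] firstFactor (y x ∷ ℓ) * łukasiewiczWeight q (+ 0) (y x ∷ ℓ))
      ≡⟨ sumBelow-cong (suc n) (λ {x} _ → firstStep x) ⟩
    (∑[ x < suc n ] (+ 1) / suc x * afterFirstStep q n n′ x x) ∎
    where
    n = suc n′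
    R = stepRange n
    W = words R n′
    y : ℕ → ℤ
    y x = + x ℤ.- ℤ.1ℤ
    firstStep : ∀ x → (∑[ ℓ ∈ W ] firstFactor (y x ∷ ℓ) * łukasiewiczWeight q (+ 0) (y x ∷ ℓ)) ≡
                      (+ 1) / suc x * afterFirstStep q n n′ x x
    firstStep x = begin
      (∑[ ℓ ∈ W ] firstFactor (y x ∷ ℓ) * łukasiewiczWeight q (+ 0) (y x ∷ ℓ))
        ≡⟨ sumOver-cong (λ ℓ → cong (_* łukasiewiczWeight q (+ 0) (y x ∷ ℓ)) (firstFactor-step x ℓ)) W ⟩
      (∑[ ℓ ∈ W ] (+ 1) / suc x * łukasiewiczWeight q (+ 0) (y x ∷ ℓ))
        ≡⟨ *-distribˡ-sumOver ((+ 1) / suc x) (λ ℓ → łukasiewiczWeight q (+ 0) (y x ∷ ℓ)) W ⟨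
      (+ 1) / suc x * (∑[ ℓ ∈ W ] łukasiewiczWeight q (+ 0) (y x ∷ ℓ))
        ≡⟨ cong ((+ 1) / suc x *_) (sumOver-firstStep q n n′ 0 x) ⟩
      (+ 1) / suc x * afterFirstStep q n n′ x x ∎

  multinomialSum-ppfWeight≡sumOver-Łuk : ∀ q n′ → let n = suc n′ in
    multinomialSum (suc n) (suc n) (ppfWeight q n) ≡ q ^ℚ n * (∑[ ℓ ∈ Łuk n ] pathWeight q ℓ)
  multinomialSum-ppfWeight≡sumOver-Łuk q n′ =
    trans (multinomialSum-ppfWeight-byFirstStep q n′) (cong (q ^ℚ suc n′ *_) (sym (sumOver-Łuk-byFirstStep q n′)))

theorem1p4 : (n : ℕ) → 1 ≤ n → (q : ℚ) → PPFpoly (suc n) q ≡ RHS n q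
theorem1p4 (suc n′) (s≤s z≤n) q = begin
  PPFpoly (suc n) q                                                  ≡⟨ PPFpoly≡multinomialSum q n ⟩
  fromℕ (suc n !) ℚ.* multinomialSum (suc n) (suc n) (ppfWeight q n) ≡⟨ cong (fromℕ (suc n !) ℚ.*_)
                                                                          (multinomialSum-ppfWeight≡sumOver-Łuk q n′) ⟩
  fromℕ (suc n !) ℚ.* (q ^ℚ n ℚ.* pathWeights)                       ≡⟨ ℚP.*-assoc (fromℕ (suc n !)) (q ^ℚ n) pathWeights ⟨
  RHS n q                                                            ∎
  where
  n = suc n′
  pathWeights = sumℚ (map (pathWeight q) (Łuk n))
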